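{- Let $d=2m$ with $m\ge3$ odd, and let $f=a_1x_1^d+\dots+a_sx_s^d$ be an additive form over $K=\mathbb{Q}_2(\sqrt5)$. Suppose there is a level $k\in\mathbb Z/d\mathbb Z$ such that the three elements of $\mathbb F_4^\times$ can be labeled $c_1,c_2,c_3$ so that among the variables of level $k$ at least $1$ has class $c_1$, at least $3$ have class $c_2$, and at least $3$ have class $c_3$. Then $f$ has a nontrivial zero in $K$.
   Context: $K=\mathbb{Q}_2(\sqrt5)$ has ring of integers $\mathcal O=\mathbb Z_2[\alpha]$, $\alpha=(1+\sqrt5)/2$; $2$ is a uniformizer and $\mathcal O/2\mathcal O\cong\mathbb F_4$. A nontrivial zero is $(x_1,\dots,x_s)\in K^s\setminus\{0\}$ with $f=0$. For a variable $x_i$ with $a_i\neq0$ write $a_i=2^{v_i}u_i$ with $v_i\in\mathbb Z$, $u_i\in\mathcal O^\times$. The level of $x_i$ is $v_i\bmod d\in\mathbb Z/d\mathbb Z$ and its class is the image of $u_i$ in $\mathbb F_4^\times$. Only variables with nonzero coefficient are assigned levels and counted. -}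

module Defs where

open import Data.Nat as ℕ using (ℕ; zero; suc)
open import Data.Integer as ℤ using (ℤ; +_; -[1+_])
open import Data.Integer.Divisibility using (_∣_)
open import Data.Product using (_×_; _,_; proj₁; proj₂; Σ; ∃)
open import Data.Fin using (Fin)
open import Relation.Nullary using (¬_)

pow2 : ℕ → ℤ
pow2 n = + (2 ℕ.^ n)

_≡[_]_ : ℤ → ℕ → ℤ → Set
x ≡[ n ] y = pow2 n ∣ (x ℤ.- y)

-- The ring of integers 𝒪 = ℤ₂[α], α² = α + 1, of K = ℚ₂(√5),
-- realised as the inverse limit of 𝒪/2ⁿ𝒪 = (ℤ/2ⁿ)[α]/(α²-α-1).
-- A raw element is a sequence n ↦ (a n , b n) of integer pairs, where
-- a n + b n·α is the approximation modulo 2ⁿ.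

Raw𝒪 : Set
Raw𝒪 = ℕ → ℤ × ℤ

Coherent : Raw𝒪 → Set
Coherent x = ∀ n → (proj₁ (x (suc n)) ≡[ n ] proj₁ (x n))
                 × (proj₂ (x (suc n)) ≡[ n ] proj₂ (x n))

record 𝒪 : Set where
  constructor mk𝒪
  field
    seq : Raw𝒪
    coh : Coherent seq
open 𝒪 public

_≈𝒪_ : Raw𝒪 → Raw𝒪 → Set
x ≈𝒪 y = ∀ n → (proj₁ (x n) ≡[ n ] proj₁ (y n))
               × (proj₂ (x n) ≡[ n ] proj₂ (y n))

0𝒪 : Raw𝒪
0𝒪 n = (+ 0 , + 0)

1𝒪 : Raw𝒪
1𝒪 n = (+ 1 , + 0)

_+𝒪_ : Raw𝒪 → Raw𝒪 → Raw𝒪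
(x +𝒪 y) n = (proj₁ (x n) ℤ.+ proj₁ (y n) , proj₂ (x n) ℤ.+ proj₂ (y n))

-- (a + bα)(c + eα) = (ac + be) + (ae + bc + be)α   since α² = α + 1
_*𝒪_ : Raw𝒪 → Raw𝒪 → Raw𝒪
(x *𝒪 y) n with x n | y n
... | (a , b) | (c , e) = (a ℤ.* c ℤ.+ b ℤ.* e , a ℤ.* e ℤ.+ b ℤ.* c ℤ.+ b ℤ.* e)

_^𝒪_ : Raw𝒪 → ℕ → Raw𝒪
x ^𝒪 zero    = 1𝒪
x ^𝒪 suc k   = x *𝒪 (x ^𝒪 k)

scale2 : ℕ → Raw𝒪 → Raw𝒪
scale2 k x n = (pow2 k ℤ.* proj₁ (x n) , pow2 k ℤ.* proj₂ (x n))

-- The field K = 𝒪[1/2] = ℚ₂(√5): an element is num / 2^den.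

record RawK : Set where
  constructor _/2^_
  field
    num : Raw𝒪
    den : ℕ
open RawK public

record K : Set where
  constructor mkK
  field
    numK : 𝒪
    denK : ℕ
open K public

toRaw : K → RawK
toRaw x = seq (numK x) /2^ denK x

_≈K_ : RawK → RawK → Set
x ≈K y = scale2 (den y) (num x) ≈𝒪 scale2 (den x) (num y)

0K : RawK
0K = 0𝒪 /2^ 0

1K : RawK
1K = 1𝒪 /2^ 0

_+K_ : RawK → RawK → RawK
x +K y = (scale2 (den y) (num x) +𝒪 scale2 (den x) (num y)) /2^ (den x ℕ.+ den y)

_*K_ : RawK → RawK → RawK
x *K y = (num x *𝒪 num y) /2^ (den x ℕ.+ den y)

_^K_ : RawK → ℕ → RawK
x ^K k = (num x ^𝒪 k) /2^ (k ℕ.* den x)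

twoPow : ℤ → 𝒪 → RawK
twoPow (+ n)     u = scale2 n (seq u) /2^ 0
twoPow -[1+ n ]  u = seq u /2^ suc n

sumK : ∀ {s} → (Fin s → RawK) → RawK
sumK {zero}  g = 0K
sumK {suc s} g = g Fin.zero +K sumK (λ i → g (Fin.suc i))
  where import Data.Fin as Fin

evalForm : ∀ {s} → ℕ → (Fin s → K) → (Fin s → K) → RawK
evalForm d a x = sumK (λ i → toRaw (a i) *K (toRaw (x i) ^K d))

-- 𝔽₄ˣ = (𝒪/2𝒪)ˣ, elements 1, ᾱ, ᾱ² = ᾱ + 1.

data 𝔽₄ˣ : Set where
  one ω ω² : 𝔽₄ˣ

code : 𝔽₄ˣ → ℤ × ℤ
code one = (+ 1 , + 0)
code ω   = (+ 0 , + 1)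
code ω²  = (+ 1 , + 1)

-- u ∈ 𝒪 has class c: the reduction of u mod 2 is c (in particular u is a unit)
HasClass : 𝒪 → 𝔽₄ˣ → Set
HasClass u c = (proj₁ (seq u 1) ≡[ 1 ] proj₁ (code c))
             × (proj₂ (seq u 1) ≡[ 1 ] proj₂ (code c))

LevelClass : ℕ → K → ℤ → 𝔽₄ˣ → Set
LevelClass d a k c =
  Σ ℤ λ v → Σ 𝒪 λ u →
    (toRaw a ≈K twoPow v u) × HasClass u c × ((+ d) ∣ (v ℤ.- k))

-- Write the seven coefficients as 2^vⱼ uⱼ with vⱼ ≡ k (mod d). Rescaling xⱼ by powers of 2 gives all
-- seven terms a common factor 2^Λ, so it suffices to find yⱼ ∈ 𝒪, one of them a unit, with
-- Σ uⱼ yⱼ^d = 0. Since d = 2m with m odd, 1^d ≡ 1 and (1 + 2α)^d ≡ 5 (mod 8). Among the sets of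
-- variables whose classes sum to 0 in 𝔽₄ some S has Σ_S uⱼ ≡ 0 (mod 4), by an exhaustive check over
-- the residues of the uⱼ modulo 4; the remaining multiple of 4 modulo 8 is cancelled by giving one
-- c₂-variable and/or one c₃-variable of S the value 1 + 2α, because c₂, c₃ and c₂ + c₃ exhaust 𝔽₄ˣ.
-- As the derivative d u y^(d-1) of a unit has valuation exactly 1, Hensel's lemma lifts this
-- solution modulo 8 to a root in 𝒪, one binary digit at a time.
module Submission where

open import Defs
open import Data.Nat using (ℕ; _≤_; _*_; _%_)
open import Data.Nat using (_+_)
open import Data.Integer using (ℤ)
open import Data.Fin using (Fin; zero; suc)
open import Data.Product using (Σ; ∃; _×_; _,_)
open import Relation.Binary.PropositionalEquality using (_≡_; _≢_)
open import Relation.Nullary using (¬_)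
open import Function.Definitions using (Injective)
open import Data.Nat.Properties using (*-comm)
open import Data.Nat.DivMod using (_/_; m≡m%n+[m/n]*n)
open import Relation.Binary.PropositionalEquality using (refl; trans; cong)

module Arithmetic where
  open import Level using (0ℓ)
  open import Data.Nat as ℕ using (ℕ; zero; suc)
  import Data.Nat.Properties as ℕP
  open import Data.Integer as ℤ using (ℤ; +_)
  import Data.Integer.Properties as ℤP
  open import Data.Product using (_×_; _,_; proj₁; proj₂)
  open import Data.Maybe using (Maybe; nothing; just)
  open import Relation.Binary.PropositionalEquality
  open import Algebra.Bundles using (CommutativeRing)
  open import Algebra.Structures using (IsCommutativeRing)
  import Data.Integer.Tactic.RingSolver as ℤ-Solver
  open import Tactic.RingSolver using (solve-∀)
  open import Tactic.RingSolver.Core.AlmostCommutativeRing using (AlmostCommutativeRing; fromCommutativeRing)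

  -- (a , b) stands for a + bα in ℤ[α], α² = α + 1, exactly as the levels of Raw𝒪.
  ℤ[α] : Set
  ℤ[α] = ℤ × ℤ

  infixl 6 _⊕_
  infixl 7 _⊗_
  infixr 8 _^_

  _⊕_ : ℤ[α] → ℤ[α] → ℤ[α]
  (a , b) ⊕ (c , e) = (a ℤ.+ c , b ℤ.+ e)

  _⊗_ : ℤ[α] → ℤ[α] → ℤ[α]
  (a , b) ⊗ (c , e) = (a ℤ.* c ℤ.+ b ℤ.* e , a ℤ.* e ℤ.+ b ℤ.* c ℤ.+ b ℤ.* e)

  ⊝_ : ℤ[α] → ℤ[α]
  ⊝ (a , b) = (ℤ.- a , ℤ.- b)

  𝟘 𝟙 : ℤ[α]
  𝟘 = (+ 0 , + 0)
  𝟙 = (+ 1 , + 0)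

  ℤ[α]-isCommutativeRing : IsCommutativeRing _≡_ _⊕_ _⊗_ ⊝_ 𝟘 𝟙
  ℤ[α]-isCommutativeRing = record
    { isRing = record
      { +-isAbelianGroup = record
        { isGroup = record
          { isMonoid = record
            { isSemigroup = record
              { isMagma = record { isEquivalence = isEquivalence ; ∙-cong = cong₂ _⊕_ }
              ; assoc = λ (a , b) (c , e) (f , g) → cong₂ _,_ (+-assoc a c f) (+-assoc b e g) }
            ; identity = (λ (a , b) → cong₂ _,_ (+-identityˡ a) (+-identityˡ b))
                       , (λ (a , b) → cong₂ _,_ (+-identityʳ a) (+-identityʳ b)) }
          ; inverse = (λ (a , b) → cong₂ _,_ (+-inverseˡ a) (+-inverseˡ b))
                    , (λ (a , b) → cong₂ _,_ (+-inverseʳ a) (+-inverseʳ b))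
          ; ⁻¹-cong = cong ⊝_ }
        ; comm = λ (a , b) (c , e) → cong₂ _,_ (+-comm a c) (+-comm b e) }
      ; *-cong = cong₂ _⊗_
      ; *-assoc = λ (a , b) (c , e) (f , g) → cong₂ _,_ (*-assoc₁ a b c e f g) (*-assoc₂ a b c e f g)
      ; *-identity = (λ (a , b) → cong₂ _,_ (*-identityˡ₁ a b) (*-identityˡ₂ a b))
                   , (λ (a , b) → cong₂ _,_ (*-identityʳ₁ a b) (*-identityʳ₂ a b))
      ; distrib = (λ (a , b) (c , e) (f , g) → cong₂ _,_ (distribˡ₁ a b c e f g) (distribˡ₂ a b c e f g))
                , (λ (a , b) (c , e) (f , g) → cong₂ _,_ (distribʳ₁ a b c e f g) (distribʳ₂ a b c e f g)) }
    ; *-comm = λ (a , b) (c , e) → cong₂ _,_ (*-comm₁ a b c e) (*-comm₂ a b c e) }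
    where
    +-assoc : ∀ a b c → a ℤ.+ b ℤ.+ c ≡ a ℤ.+ (b ℤ.+ c)
    +-assoc = ℤ-Solver.solve-∀
    +-identityˡ : ∀ a → + 0 ℤ.+ a ≡ a
    +-identityˡ = ℤ-Solver.solve-∀
    +-identityʳ : ∀ a → a ℤ.+ + 0 ≡ a
    +-identityʳ = ℤ-Solver.solve-∀
    +-inverseˡ : ∀ a → ℤ.- a ℤ.+ a ≡ + 0
    +-inverseˡ = ℤ-Solver.solve-∀
    +-inverseʳ : ∀ a → a ℤ.+ ℤ.- a ≡ + 0
    +-inverseʳ = ℤ-Solver.solve-∀
    +-comm : ∀ a b → a ℤ.+ b ≡ b ℤ.+ a
    +-comm = ℤ-Solver.solve-∀
    *-assoc₁ : ∀ a b c e f g → (a ℤ.* c ℤ.+ b ℤ.* e) ℤ.* f ℤ.+ (a ℤ.* e ℤ.+ b ℤ.* c ℤ.+ b ℤ.* e) ℤ.* g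
                             ≡ a ℤ.* (c ℤ.* f ℤ.+ e ℤ.* g) ℤ.+ b ℤ.* (c ℤ.* g ℤ.+ e ℤ.* f ℤ.+ e ℤ.* g)
    *-assoc₁ = ℤ-Solver.solve-∀
    *-assoc₂ : ∀ a b c e f g → (a ℤ.* c ℤ.+ b ℤ.* e) ℤ.* g ℤ.+ (a ℤ.* e ℤ.+ b ℤ.* c ℤ.+ b ℤ.* e) ℤ.* f
                                 ℤ.+ (a ℤ.* e ℤ.+ b ℤ.* c ℤ.+ b ℤ.* e) ℤ.* g
                             ≡ a ℤ.* (c ℤ.* g ℤ.+ e ℤ.* f ℤ.+ e ℤ.* g) ℤ.+ b ℤ.* (c ℤ.* f ℤ.+ e ℤ.* g)
                                 ℤ.+ b ℤ.* (c ℤ.* g ℤ.+ e ℤ.* f ℤ.+ e ℤ.* g)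
    *-assoc₂ = ℤ-Solver.solve-∀
    *-identityˡ₁ : ∀ a b → + 1 ℤ.* a ℤ.+ + 0 ℤ.* b ≡ a
    *-identityˡ₁ = ℤ-Solver.solve-∀
    *-identityˡ₂ : ∀ a b → + 1 ℤ.* b ℤ.+ + 0 ℤ.* a ℤ.+ + 0 ℤ.* b ≡ b
    *-identityˡ₂ = ℤ-Solver.solve-∀
    *-identityʳ₁ : ∀ a b → a ℤ.* + 1 ℤ.+ b ℤ.* + 0 ≡ a
    *-identityʳ₁ = ℤ-Solver.solve-∀
    *-identityʳ₂ : ∀ a b → a ℤ.* + 0 ℤ.+ b ℤ.* + 1 ℤ.+ b ℤ.* + 0 ≡ b
    *-identityʳ₂ = ℤ-Solver.solve-∀
    distribˡ₁ : ∀ a b c e f g → a ℤ.* (c ℤ.+ f) ℤ.+ b ℤ.* (e ℤ.+ g) ≡ a ℤ.* c ℤ.+ b ℤ.* e ℤ.+ (a ℤ.* f ℤ.+ b ℤ.* g)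
    distribˡ₁ = ℤ-Solver.solve-∀
    distribˡ₂ : ∀ a b c e f g → a ℤ.* (e ℤ.+ g) ℤ.+ b ℤ.* (c ℤ.+ f) ℤ.+ b ℤ.* (e ℤ.+ g)
                              ≡ a ℤ.* e ℤ.+ b ℤ.* c ℤ.+ b ℤ.* e ℤ.+ (a ℤ.* g ℤ.+ b ℤ.* f ℤ.+ b ℤ.* g)
    distribˡ₂ = ℤ-Solver.solve-∀
    distribʳ₁ : ∀ a b c e f g → (c ℤ.+ f) ℤ.* a ℤ.+ (e ℤ.+ g) ℤ.* b ≡ c ℤ.* a ℤ.+ e ℤ.* b ℤ.+ (f ℤ.* a ℤ.+ g ℤ.* b)
    distribʳ₁ = ℤ-Solver.solve-∀
    distribʳ₂ : ∀ a b c e f g → (c ℤ.+ f) ℤ.* b ℤ.+ (e ℤ.+ g) ℤ.* a ℤ.+ (e ℤ.+ g) ℤ.* b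
                              ≡ c ℤ.* b ℤ.+ e ℤ.* a ℤ.+ e ℤ.* b ℤ.+ (f ℤ.* b ℤ.+ g ℤ.* a ℤ.+ g ℤ.* b)
    distribʳ₂ = ℤ-Solver.solve-∀
    *-comm₁ : ∀ a b c e → a ℤ.* c ℤ.+ b ℤ.* e ≡ c ℤ.* a ℤ.+ e ℤ.* b
    *-comm₁ = ℤ-Solver.solve-∀
    *-comm₂ : ∀ a b c e → a ℤ.* e ℤ.+ b ℤ.* c ℤ.+ b ℤ.* e ≡ c ℤ.* b ℤ.+ e ℤ.* a ℤ.+ e ℤ.* b
    *-comm₂ = ℤ-Solver.solve-∀

  ℤ[α]-commutativeRing : CommutativeRing 0ℓ 0ℓ
  ℤ[α]-commutativeRing = record { isCommutativeRing = ℤ[α]-isCommutativeRing }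

  ℤ[α]-ring : AlmostCommutativeRing 0ℓ 0ℓ
  ℤ[α]-ring = fromCommutativeRing ℤ[α]-commutativeRing 𝟘≟_
    where
    𝟘≟_ : ∀ x → Maybe (𝟘 ≡ x)
    𝟘≟ (+ zero , + zero) = just refl
    𝟘≟ _                 = nothing

  _^_ : ℤ[α] → ℕ → ℤ[α]
  x ^ zero  = 𝟙
  x ^ suc k = x ⊗ x ^ k

  fromℕ : ℕ → ℤ[α]
  fromℕ n = (+ n , + 0)

  𝟚^ : ℕ → ℤ[α]
  𝟚^ n = (pow2 n , + 0)

  𝟚 : ℤ[α]
  𝟚 = 𝟚^ 1

  ^𝒪-at : ∀ (x : Raw𝒪) k n → (x ^𝒪 k) n ≡ x n ^ k
  ^𝒪-at x zero    n = refl
  ^𝒪-at x (suc k) n = cong (x n ⊗_) (^𝒪-at x k n)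

  scale2-at : ∀ k (x : Raw𝒪) n → scale2 k x n ≡ 𝟚^ k ⊗ x n
  scale2-at k x n = cong₂ _,_ (lem₁ (pow2 k) (proj₁ (x n)) (proj₂ (x n))) (lem₂ (pow2 k) (proj₁ (x n)) (proj₂ (x n)))
    where
    lem₁ : ∀ p a b → p ℤ.* a ≡ p ℤ.* a ℤ.+ + 0 ℤ.* b
    lem₁ = ℤ-Solver.solve-∀
    lem₂ : ∀ p a b → p ℤ.* b ≡ p ℤ.* b ℤ.+ + 0 ℤ.* a ℤ.+ + 0 ℤ.* b
    lem₂ = ℤ-Solver.solve-∀

  fromℕ-* : ∀ a b → fromℕ (a ℕ.* b) ≡ fromℕ a ⊗ fromℕ b
  fromℕ-* a b = cong₂ _,_ (trans (ℤP.pos-* a b) (lem₁ (+ a) (+ b))) (lem₂ (+ a) (+ b))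
    where
    lem₁ : ∀ a b → a ℤ.* b ≡ a ℤ.* b ℤ.+ + 0 ℤ.* + 0
    lem₁ = ℤ-Solver.solve-∀
    lem₂ : ∀ a b → + 0 ≡ a ℤ.* + 0 ℤ.+ + 0 ℤ.* b ℤ.+ + 0 ℤ.* + 0
    lem₂ = ℤ-Solver.solve-∀

  𝟚^-+ : ∀ a b → 𝟚^ (a ℕ.+ b) ≡ 𝟚^ a ⊗ 𝟚^ b
  𝟚^-+ a b = trans (cong fromℕ (ℕP.^-distribˡ-+-* 2 a b)) (fromℕ-* (2 ℕ.^ a) (2 ℕ.^ b))

  ^-+ : ∀ x a b → x ^ (a ℕ.+ b) ≡ x ^ a ⊗ x ^ b
  ^-+ x zero    b = sym (lem (x ^ b))
    where
    lem : ∀ y → 𝟙 ⊗ y ≡ y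
    lem = solve-∀ ℤ[α]-ring
  ^-+ x (suc a) b = trans (cong (x ⊗_) (^-+ x a b)) (lem x (x ^ a) (x ^ b))
    where
    lem : ∀ x y z → x ⊗ (y ⊗ z) ≡ (x ⊗ y) ⊗ z
    lem = solve-∀ ℤ[α]-ring

  ^-distrib-⊗ : ∀ x y k → (x ⊗ y) ^ k ≡ x ^ k ⊗ y ^ k
  ^-distrib-⊗ x y zero    = refl
  ^-distrib-⊗ x y (suc k) = trans (cong ((x ⊗ y) ⊗_) (^-distrib-⊗ x y k)) (lem x y (x ^ k) (y ^ k))
    where
    lem : ∀ x y a b → (x ⊗ y) ⊗ (a ⊗ b) ≡ (x ⊗ a) ⊗ (y ⊗ b)
    lem = solve-∀ ℤ[α]-ring

  ^-*2 : ∀ x k → x ^ (2 ℕ.* k) ≡ (x ⊗ x) ^ k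
  ^-*2 x k = trans (^-+ x k (k ℕ.+ 0)) (trans (cong (λ w → x ^ k ⊗ x ^ w) (ℕP.+-identityʳ k)) (sym (^-distrib-⊗ x x k)))

  𝟙^ : ∀ k → 𝟙 ^ k ≡ 𝟙
  𝟙^ zero    = refl
  𝟙^ (suc k) = cong (𝟙 ⊗_) (𝟙^ k)

  𝟚^-^ : ∀ a k → 𝟚^ a ^ k ≡ 𝟚^ (k ℕ.* a)
  𝟚^-^ a zero    = refl
  𝟚^-^ a (suc k) = trans (cong (𝟚^ a ⊗_) (𝟚^-^ a k)) (sym (𝟚^-+ a (k ℕ.* a)))

module Congruence where
  open import Data.Nat as ℕ using (ℕ; zero; suc; _≤_)
  import Data.Nat.Properties as ℕP
  open import Data.Integer as ℤ using (ℤ; +_)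
  import Data.Integer.Properties as ℤP
  import Data.Integer.Divisibility.Signed as Signed
  open import Data.Product using (_×_; _,_; proj₁; proj₂)
  open import Function using (_$_)
  open import Relation.Binary.Bundles using (Setoid)
  open import Relation.Binary.PropositionalEquality
  open import Relation.Nullary using (Dec; yes; no)
  import Data.Integer.Tactic.RingSolver as ℤ-Solver
  open import Tactic.RingSolver using (solve-∀)
  open Arithmetic

  infix 4 _≋[_]_ _≋[_]?_

  record _≋[_]_ (x : ℤ[α]) (n : ℕ) (y : ℤ[α]) : Set where
    constructor congruent
    field
      quotient : ℤ[α]
      equality : x ≡ y ⊕ 𝟚^ n ⊗ quotient

  open _≋[_]_ public

  private
    refl-lemma : ∀ x t → x ≡ x ⊕ t ⊗ 𝟘
    refl-lemma = solve-∀ ℤ[α]-ring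
    sym-lemma : ∀ y t q → y ≡ (y ⊕ t ⊗ q) ⊕ t ⊗ (⊝ q)
    sym-lemma = solve-∀ ℤ[α]-ring
    trans-lemma : ∀ z t q r → (z ⊕ t ⊗ r) ⊕ t ⊗ q ≡ z ⊕ t ⊗ (q ⊕ r)
    trans-lemma = solve-∀ ℤ[α]-ring
    ⊕-lemma : ∀ x y t q r → (x ⊕ t ⊗ q) ⊕ (y ⊕ t ⊗ r) ≡ (x ⊕ y) ⊕ t ⊗ (q ⊕ r)
    ⊕-lemma = solve-∀ ℤ[α]-ring
    ⊗-lemma : ∀ x y t q r → (x ⊕ t ⊗ q) ⊗ (y ⊕ t ⊗ r) ≡ (x ⊗ y) ⊕ t ⊗ (q ⊗ y ⊕ x ⊗ r ⊕ t ⊗ q ⊗ r)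
    ⊗-lemma = solve-∀ ℤ[α]-ring
    multiple-lemma : ∀ t q → t ⊗ q ≡ 𝟘 ⊕ t ⊗ q
    multiple-lemma = solve-∀ ℤ[α]-ring
    weaken-lemma : ∀ y a b q → y ⊕ (a ⊗ b) ⊗ q ≡ y ⊕ a ⊗ (b ⊗ q)
    weaken-lemma = solve-∀ ℤ[α]-ring
    scale-lemma : ∀ s y t q → s ⊗ (y ⊕ t ⊗ q) ≡ s ⊗ y ⊕ (t ⊗ s) ⊗ q
    scale-lemma = solve-∀ ℤ[α]-ring

  ≡⇒≋ : ∀ {n x y} → x ≡ y → x ≋[ n ] y
  ≡⇒≋ {n} {x} refl = congruent 𝟘 (refl-lemma x (𝟚^ n))

  ≋-refl : ∀ {n x} → x ≋[ n ] x
  ≋-refl = ≡⇒≋ refl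

  ≋-sym : ∀ {n x y} → x ≋[ n ] y → y ≋[ n ] x
  ≋-sym {n} {y = y} (congruent q refl) = congruent (⊝ q) (sym-lemma y (𝟚^ n) q)

  ≋-trans : ∀ {n x y z} → x ≋[ n ] y → y ≋[ n ] z → x ≋[ n ] z
  ≋-trans {n} {z = z} (congruent q refl) (congruent r refl) = congruent (q ⊕ r) (trans-lemma z (𝟚^ n) q r)

  ≋-setoid : ℕ → Setoid _ _
  ≋-setoid n = record
    { Carrier       = ℤ[α]
    ; _≈_           = λ x y → x ≋[ n ] y
    ; isEquivalence = record { refl = ≋-refl ; sym = ≋-sym ; trans = ≋-trans } }

  module ≋-Reasoning (n : ℕ) where
    open import Relation.Binary.Reasoning.Setoid (≋-setoid n) public

  ⊕-cong : ∀ {n x x′ y y′} → x ≋[ n ] x′ → y ≋[ n ] y′ → x ⊕ y ≋[ n ] x′ ⊕ y′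
  ⊕-cong {n} {x′ = x′} {y′ = y′} (congruent q refl) (congruent r refl) = congruent (q ⊕ r) (⊕-lemma x′ y′ (𝟚^ n) q r)

  ⊗-cong : ∀ {n x x′ y y′} → x ≋[ n ] x′ → y ≋[ n ] y′ → x ⊗ y ≋[ n ] x′ ⊗ y′
  ⊗-cong {n} {x′ = x′} {y′ = y′} (congruent q refl) (congruent r refl) = congruent _ (⊗-lemma x′ y′ (𝟚^ n) q r)

  ⊗-congˡ : ∀ {n} c {y y′} → y ≋[ n ] y′ → c ⊗ y ≋[ n ] c ⊗ y′
  ⊗-congˡ c = ⊗-cong (≋-refl {x = c})

  ⊗-congʳ : ∀ {n} c {y y′} → y ≋[ n ] y′ → y ⊗ c ≋[ n ] y′ ⊗ c
  ⊗-congʳ c h = ⊗-cong h (≋-refl {x = c})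

  ^-cong : ∀ {n x y} k → x ≋[ n ] y → x ^ k ≋[ n ] y ^ k
  ^-cong zero    h = ≋-refl
  ^-cong (suc k) h = ⊗-cong h (^-cong k h)

  𝟚^⊗≋𝟘 : ∀ {n} q → 𝟚^ n ⊗ q ≋[ n ] 𝟘
  𝟚^⊗≋𝟘 {n} q = congruent q (multiple-lemma (𝟚^ n) q)

  ≋-weaken : ∀ {m n x y} → m ≤ n → x ≋[ n ] y → x ≋[ m ] y
  ≋-weaken {m} {n} {y = y} m≤n (congruent q refl) = congruent (𝟚^ (n ℕ.∸ m) ⊗ q) $
    trans (cong (λ t → y ⊕ t ⊗ q) (trans (cong 𝟚^ (sym (ℕP.m+[n∸m]≡n m≤n))) (𝟚^-+ m (n ℕ.∸ m))))
          (weaken-lemma y (𝟚^ m) (𝟚^ (n ℕ.∸ m)) q)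

  𝟚^⊗-cong : ∀ {n x y} k → x ≋[ n ] y → 𝟚^ k ⊗ x ≋[ n ℕ.+ k ] 𝟚^ k ⊗ y
  𝟚^⊗-cong {n} {y = y} k (congruent q refl) = congruent q $
    trans (scale-lemma (𝟚^ k) y (𝟚^ n) q) (cong (λ t → 𝟚^ k ⊗ y ⊕ t ⊗ q) (sym (𝟚^-+ n k)))

  𝟚^⊗-cancel : ∀ {n x y} k → 𝟚^ k ⊗ x ≋[ n ℕ.+ k ] 𝟚^ k ⊗ y → x ≋[ n ] y
  𝟚^⊗-cancel {n} {x} {y} k (congruent q e) = congruent q $
    𝟚^⊗-injective (trans e (trans (cong (λ t → 𝟚^ k ⊗ y ⊕ t ⊗ q) (𝟚^-+ n k)) (sym (scale-lemma (𝟚^ k) y (𝟚^ n) q))))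
    where
    lem₁ : ∀ c a b → c ℤ.* a ℤ.+ + 0 ℤ.* b ≡ c ℤ.* a
    lem₁ = ℤ-Solver.solve-∀
    lem₂ : ∀ c a b → c ℤ.* b ℤ.+ + 0 ℤ.* a ℤ.+ + 0 ℤ.* b ≡ c ℤ.* b
    lem₂ = ℤ-Solver.solve-∀
    𝟚^⊗-injective : ∀ {a b} → 𝟚^ k ⊗ a ≡ 𝟚^ k ⊗ b → a ≡ b
    𝟚^⊗-injective {a₁ , a₂} {b₁ , b₂} e = cong₂ _,_
      (ℤP.*-cancelˡ-≡ (pow2 k) a₁ b₁ {{ℕP.m^n≢0 2 k}}
         (trans (sym (lem₁ (pow2 k) a₁ a₂)) (trans (cong proj₁ e) (lem₁ (pow2 k) b₁ b₂))))
      (ℤP.*-cancelˡ-≡ (pow2 k) a₂ b₂ {{ℕP.m^n≢0 2 k}}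
         (trans (sym (lem₂ (pow2 k) a₁ a₂)) (trans (cong proj₂ e) (lem₂ (pow2 k) b₁ b₂))))

  module _ {n : ℕ} where
    private
      sub₁ : ∀ y p q₁ q₂ → (y ℤ.+ (p ℤ.* q₁ ℤ.+ + 0 ℤ.* q₂)) ℤ.- y ≡ q₁ ℤ.* p
      sub₁ = ℤ-Solver.solve-∀
      sub₂ : ∀ y p q₁ q₂ → (y ℤ.+ (p ℤ.* q₂ ℤ.+ + 0 ℤ.* q₁ ℤ.+ + 0 ℤ.* q₂)) ℤ.- y ≡ q₂ ℤ.* p
      sub₂ = ℤ-Solver.solve-∀
      add₁ : ∀ x y p q₁ q₂ → x ℤ.- y ≡ q₁ ℤ.* p → x ≡ y ℤ.+ (p ℤ.* q₁ ℤ.+ + 0 ℤ.* q₂)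
      add₁ x y p q₁ q₂ e = trans (lem x y) (trans (cong (λ w → y ℤ.+ w) e) (lem′ y p q₁ q₂))
        where
        lem : ∀ x y → x ≡ y ℤ.+ (x ℤ.- y)
        lem = ℤ-Solver.solve-∀
        lem′ : ∀ y p q₁ q₂ → y ℤ.+ q₁ ℤ.* p ≡ y ℤ.+ (p ℤ.* q₁ ℤ.+ + 0 ℤ.* q₂)
        lem′ = ℤ-Solver.solve-∀
      add₂ : ∀ x y p q₁ q₂ → x ℤ.- y ≡ q₂ ℤ.* p → x ≡ y ℤ.+ (p ℤ.* q₂ ℤ.+ + 0 ℤ.* q₁ ℤ.+ + 0 ℤ.* q₂)
      add₂ x y p q₁ q₂ e = trans (lem x y) (trans (cong (λ w → y ℤ.+ w) e) (lem′ y p q₁ q₂))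
        where
        lem : ∀ x y → x ≡ y ℤ.+ (x ℤ.- y)
        lem = ℤ-Solver.solve-∀
        lem′ : ∀ y p q₁ q₂ → y ℤ.+ q₂ ℤ.* p ≡ y ℤ.+ (p ℤ.* q₂ ℤ.+ + 0 ℤ.* q₁ ℤ.+ + 0 ℤ.* q₂)
        lem′ = ℤ-Solver.solve-∀

    ≋⇒∣₁ : ∀ {x y} → x ≋[ n ] y → pow2 n Signed.∣ (proj₁ x ℤ.- proj₁ y)
    ≋⇒∣₁ {y = y₁ , y₂} (congruent (q₁ , q₂) refl) = Signed.divides q₁ (sub₁ y₁ (pow2 n) q₁ q₂)

    ≋⇒∣₂ : ∀ {x y} → x ≋[ n ] y → pow2 n Signed.∣ (proj₂ x ℤ.- proj₂ y)
    ≋⇒∣₂ {y = y₁ , y₂} (congruent (q₁ , q₂) refl) = Signed.divides q₂ (sub₂ y₂ (pow2 n) q₁ q₂)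

    ∣⇒≋ : ∀ {x y} → pow2 n Signed.∣ (proj₁ x ℤ.- proj₁ y) → pow2 n Signed.∣ (proj₂ x ℤ.- proj₂ y) → x ≋[ n ] y
    ∣⇒≋ {x₁ , x₂} {y₁ , y₂} (Signed.divides q₁ e₁) (Signed.divides q₂ e₂) =
      congruent (q₁ , q₂) (cong₂ _,_ (add₁ x₁ y₁ (pow2 n) q₁ q₂ e₁) (add₂ x₂ y₂ (pow2 n) q₁ q₂ e₂))

    ≋⇒≡[] : ∀ {x y} → x ≋[ n ] y → (proj₁ x ≡[ n ] proj₁ y) × (proj₂ x ≡[ n ] proj₂ y)
    ≋⇒≡[] h = Signed.∣⇒∣ᵤ (≋⇒∣₁ h) , Signed.∣⇒∣ᵤ (≋⇒∣₂ h)

    ≡[]⇒≋ : ∀ {x y} → proj₁ x ≡[ n ] proj₁ y → proj₂ x ≡[ n ] proj₂ y → x ≋[ n ] y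
    ≡[]⇒≋ a b = ∣⇒≋ (Signed.∣ᵤ⇒∣ a) (Signed.∣ᵤ⇒∣ b)

  _≋[_]?_ : ∀ x n y → Dec (x ≋[ n ] y)
  x ≋[ n ]? y with pow2 n Signed.∣? (proj₁ x ℤ.- proj₁ y) | pow2 n Signed.∣? (proj₂ x ℤ.- proj₂ y)
  ... | yes a | yes b = yes (∣⇒≋ a b)
  ... | no ¬a | _     = no (λ h → ¬a (≋⇒∣₁ h))
  ... | yes _ | no ¬b = no (λ h → ¬b (≋⇒∣₂ h))

  ≈𝒪⇒≋ : ∀ {x y : Raw𝒪} → x ≈𝒪 y → ∀ n → x n ≋[ n ] y n
  ≈𝒪⇒≋ h n = ≡[]⇒≋ (proj₁ (h n)) (proj₂ (h n))

  ≋⇒≈𝒪 : ∀ {x y : Raw𝒪} → (∀ n → x n ≋[ n ] y n) → x ≈𝒪 y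
  ≋⇒≈𝒪 h n = ≋⇒≡[] (h n)

  IsCoherent : (ℕ → ℤ[α]) → Set
  IsCoherent x = ∀ n → x (suc n) ≋[ n ] x n

  seq-coherent : (x : 𝒪) → IsCoherent (seq x)
  seq-coherent x n = ≡[]⇒≋ (proj₁ (coh x n)) (proj₂ (coh x n))

  IsCoherent⇒Coherent : ∀ {x} → IsCoherent x → Coherent x
  IsCoherent⇒Coherent h n = ≋⇒≡[] (h n)

  IsCoherent-+ : ∀ {x} → IsCoherent x → ∀ c n → x (c ℕ.+ n) ≋[ n ] x n
  IsCoherent-+ h zero    n = ≋-refl
  IsCoherent-+ h (suc c) n = ≋-trans (≋-weaken (ℕP.m≤n+m n c) (h (c ℕ.+ n))) (IsCoherent-+ h c n)

module Residues where
  open import Data.Nat as ℕ using (ℕ; zero; suc; s≤s)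
  open import Data.Integer as ℤ using (ℤ; +_)
  open import Data.Integer.DivMod using (_%ℕ_; _/ℕ_; a≡a%ℕn+[a/ℕn]*n; n%ℕd<d)
  open import Data.Product using (_,_; Σ)
  open import Data.Fin using (Fin; zero; suc)
  open import Data.Bool using (Bool; true; false; T)
  open import Data.Unit using (tt)
  open import Algebra.Bundles using (CommutativeRing)
  open import Relation.Binary.PropositionalEquality
  open import Relation.Nullary.Decidable using (isYes; toWitness)
  import Data.Integer.Tactic.RingSolver as ℤ-Solver
  open import Tactic.RingSolver using (solve-∀)
  open Arithmetic
  open Congruence

  open import Algebra.Properties.Semiring.Sum (CommutativeRing.semiring ℤ[α]-commutativeRing) public
    using (sum; ∑-distrib-+; ∑-comm; *-distribˡ-sum; sum-remove; sum-cong-≗; sum-replicate-zero)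

  sum-cong-≋ : ∀ {n m} {f g : Fin n → ℤ[α]} → (∀ i → f i ≋[ m ] g i) → sum f ≋[ m ] sum g
  sum-cong-≋ {zero}  h = ≋-refl
  sum-cong-≋ {suc n} h = ⊕-cong (h zero) (sum-cong-≋ (λ i → h (suc i)))

  -- 𝒪/2𝒪 = 𝔽₄ = {0, 1, ω, ω²} with ω = ᾱ, ω² = ᾱ + 1.
  data 𝔽₄ : Set where
    f0 f1 fω fω² : 𝔽₄

  infixl 6 _+F_
  _+F_ : 𝔽₄ → 𝔽₄ → 𝔽₄
  f0  +F g   = g
  f1  +F f0  = f1
  f1  +F f1  = f0
  f1  +F fω  = fω²
  f1  +F fω² = fω
  fω  +F f0  = fω
  fω  +F f1  = fω²
  fω  +F fω  = f0
  fω  +F fω² = f1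
  fω² +F f0  = fω²
  fω² +F f1  = fω
  fω² +F fω  = f1
  fω² +F fω² = f0

  lift : 𝔽₄ → ℤ[α]
  lift f0  = (+ 0 , + 0)
  lift f1  = (+ 1 , + 0)
  lift fω  = (+ 0 , + 1)
  lift fω² = (+ 1 , + 1)

  fromUnit : 𝔽₄ˣ → 𝔽₄
  fromUnit one = f1
  fromUnit ω   = fω
  fromUnit ω²  = fω²

  code≡lift∘fromUnit : ∀ c → code c ≡ lift (fromUnit c)
  code≡lift∘fromUnit one = refl
  code≡lift∘fromUnit ω   = refl
  code≡lift∘fromUnit ω²  = refl

  ∑F : ∀ {n} → (Fin n → 𝔽₄) → 𝔽₄
  ∑F {zero}  f = f0
  ∑F {suc n} f = f zero +F ∑F (λ i → f (suc i))

  lift-+ : ∀ f g → lift (f +F g) ≋[ 1 ] lift f ⊕ lift g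
  lift-+ f g = toWitness (table f g)
    where
    table : ∀ f g → T (isYes (lift (f +F g) ≋[ 1 ]? lift f ⊕ lift g))
    table f0  f0  = tt
    table f0  f1  = tt
    table f0  fω  = tt
    table f0  fω² = tt
    table f1  f0  = tt
    table f1  f1  = tt
    table f1  fω  = tt
    table f1  fω² = tt
    table fω  f0  = tt
    table fω  f1  = tt
    table fω  fω  = tt
    table fω  fω² = tt
    table fω² f0  = tt
    table fω² f1  = tt
    table fω² fω  = tt
    table fω² fω² = tt

  lift-∑ : ∀ {n} (f : Fin n → 𝔽₄) → sum (λ i → lift (f i)) ≋[ 1 ] lift (∑F f)
  lift-∑ {zero}  f = ≋-refl
  lift-∑ {suc n} f = ≋-trans (⊕-cong (≋-refl {x = lift (f zero)}) (lift-∑ (λ i → f (suc i))))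
                             (≋-sym (lift-+ (f zero) (∑F (λ i → f (suc i)))))

  private
    bit : Bool → ℤ
    bit false = + 0
    bit true  = + 1

    parity : ∀ a → Σ Bool λ r → Σ ℤ λ q → a ≡ bit r ℤ.+ q ℤ.* + 2
    parity a with a %ℕ 2 | a≡a%ℕn+[a/ℕn]*n a 2 | n%ℕd<d a 2
    ... | 0           | e | _             = false , a /ℕ 2 , e
    ... | 1           | e | _             = true , a /ℕ 2 , e
    ... | suc (suc _) | _ | s≤s (s≤s ())

    fromBits : Bool → Bool → 𝔽₄
    fromBits false false = f0
    fromBits true  false = f1
    fromBits false true  = fω
    fromBits true  true  = fω²

    lift-fromBits : ∀ r s → lift (fromBits r s) ≡ (bit r , bit s)
    lift-fromBits false false = refl
    lift-fromBits true  false = refl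
    lift-fromBits false true  = refl
    lift-fromBits true  true  = refl

  reduce : ∀ x → Σ 𝔽₄ λ f → x ≋[ 1 ] lift f
  reduce (a , b) with parity a | parity b
  ... | r , q₁ , e₁ | s , q₂ , e₂ = fromBits r s , congruent (q₁ , q₂)
    (trans (cong₂ _,_ (trans e₁ (lem₁ (bit r) q₁ q₂)) (trans e₂ (lem₂ (bit s) q₁ q₂)))
           (cong (_⊕ 𝟚 ⊗ (q₁ , q₂)) (sym (lift-fromBits r s))))
    where
    lem₁ : ∀ r q₁ q₂ → r ℤ.+ q₁ ℤ.* + 2 ≡ r ℤ.+ (+ 2 ℤ.* q₁ ℤ.+ + 0 ℤ.* q₂)
    lem₁ = ℤ-Solver.solve-∀
    lem₂ : ∀ r q₁ q₂ → r ℤ.+ q₂ ℤ.* + 2 ≡ r ℤ.+ (+ 2 ℤ.* q₂ ℤ.+ + 0 ℤ.* q₁ ℤ.+ + 0 ℤ.* q₂)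
    lem₂ = ℤ-Solver.solve-∀

module FiniteSearch where
  open import Data.Nat using (zero; suc)
  open import Data.Product using (_,_; proj₁; proj₂; ∃)
  open import Data.Sum using (_⊎_; inj₁; inj₂)
  open import Data.Fin using (Fin; zero; suc)
  open import Data.Bool using (Bool; true; false; _∧_; _∨_; not; T)
  open import Data.Vec as Vec using (Vec; lookup; tabulate)
  open import Data.Vec.Properties using (lookup∘tabulate)
  open import Data.Unit using (tt)
  open import Data.Empty using (⊥-elim)
  open import Relation.Binary.PropositionalEquality
  open import Relation.Nullary.Decidable using (isYes; toWitness)
  open import Tactic.RingSolver using (solve-∀)
  open Arithmetic
  open Congruence
  open Residues

  private
    T-∧ˡ : ∀ x {y} → T (x ∧ y) → T x
    T-∧ˡ true _ = tt

    T-∧ʳ : ∀ x {y} → T (x ∧ y) → T y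
    T-∧ʳ true h = h

    T-∨ : ∀ x {y} → T (x ∨ y) → T x ⊎ T y
    T-∨ true  h = inj₁ tt
    T-∨ false h = inj₂ h

    T⇒≡true : ∀ {b} → T b → b ≡ true
    T⇒≡true {true} _ = refl

  infix 7 _==_ _∈?_
  _==_ : ∀ {n} → Fin n → Fin n → Bool
  zero  == zero  = true
  suc i == suc j = i == j
  _     == _     = false

  isZero : 𝔽₄ → Bool
  isZero f0 = true
  isZero _  = false

  isZero-sound : ∀ {f} → T (isZero f) → f ≡ f0
  isZero-sound {f0} _ = refl

  -- The seven variables: slot 0 has class c₁, slots 1–3 class c₂, slots 4–6 class c₃.
  data Slot : Set where
    first         : Slot
    second third  : Fin 3 → Slot

  slot : Fin 7 → Slot
  slot zero                                   = first
  slot (suc zero)                             = second zero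
  slot (suc (suc zero))                       = second (suc zero)
  slot (suc (suc (suc zero)))                 = second (suc (suc zero))
  slot (suc (suc (suc (suc zero))))           = third zero
  slot (suc (suc (suc (suc (suc zero)))))     = third (suc zero)
  slot (suc (suc (suc (suc (suc (suc zero)))))) = third (suc (suc zero))

  classOf : 𝔽₄ˣ → 𝔽₄ˣ → 𝔽₄ˣ → Fin 7 → 𝔽₄ˣ
  classOf c₁ c₂ c₃ i with slot i
  ... | first    = c₁
  ... | second _ = c₂
  ... | third _  = c₃

  -- The sets of variables whose classes sum to 0 in 𝔽₄ and which meet both the c₂- and the c₃-slots.
  data Support : Set where
    triple quadruple      : Fin 3 → Fin 3 → Support
    quintuple₂ quintuple₃ : Fin 3 → Support
    septuple              : Support

  _∈?_ : Fin 7 → Support → Bool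
  i ∈? S = member (slot i) S
    where
    member : Slot → Support → Bool
    member first      (triple _ _)    = true
    member (second k) (triple a _)    = k == a
    member (third k)  (triple _ b)    = k == b
    member first      (quadruple _ _) = false
    member (second k) (quadruple a _) = not (k == a)
    member (third k)  (quadruple _ b) = not (k == b)
    member first      (quintuple₂ _)  = true
    member (second _) (quintuple₂ _)  = true
    member (third k)  (quintuple₂ b)  = k == b
    member first      (quintuple₃ _)  = true
    member (second k) (quintuple₃ a)  = k == a
    member (third _)  (quintuple₃ _)  = true
    member _          septuple        = true

  secondAt thirdAt : Fin 3 → Fin 7
  secondAt zero             = suc zero
  secondAt (suc zero)       = suc (suc zero)
  secondAt (suc (suc zero)) = suc (suc (suc zero))
  thirdAt zero              = suc (suc (suc (suc zero)))
  thirdAt (suc zero)        = suc (suc (suc (suc (suc zero))))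
  thirdAt (suc (suc zero))  = suc (suc (suc (suc (suc (suc zero)))))

  private
    other : Fin 3 → Fin 3
    other zero    = suc zero
    other (suc _) = zero

  pivot₂ pivot₃ : Support → Fin 7
  pivot₂ (triple a _)    = secondAt a
  pivot₂ (quadruple a _) = secondAt (other a)
  pivot₂ (quintuple₂ _)  = secondAt zero
  pivot₂ (quintuple₃ a)  = secondAt a
  pivot₂ septuple        = secondAt zero
  pivot₃ (triple _ b)    = thirdAt b
  pivot₃ (quadruple _ b) = thirdAt (other b)
  pivot₃ (quintuple₂ b)  = thirdAt b
  pivot₃ (quintuple₃ _)  = thirdAt zero
  pivot₃ septuple        = thirdAt zero

  -- Half the sum of the lifted classes over the support, modulo 2.
  κ : 𝔽₄ˣ → 𝔽₄ˣ → Support → 𝔽₄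
  κ c₂ c₃ (triple _ _)    = fω²
  κ c₂ c₃ (quadruple _ _) = fromUnit c₂ +F fromUnit c₃
  κ c₂ c₃ (quintuple₂ _)  = fω² +F fromUnit c₂
  κ c₂ c₃ (quintuple₃ _)  = fω² +F fromUnit c₃
  κ c₂ c₃ septuple        = fω² +F fromUnit c₂ +F fromUnit c₃

  mask : Bool → 𝔽₄ → 𝔽₄
  mask true  f = f
  mask false _ = f0

  indicator : Bool → ℤ[α]
  indicator true  = 𝟙
  indicator false = 𝟘

  all𝔽₄ : (𝔽₄ → Bool) → Bool
  all𝔽₄ p = p f0 ∧ p f1 ∧ p fω ∧ p fω²

  all𝔽₄-sound : ∀ p → T (all𝔽₄ p) → ∀ f → T (p f)
  all𝔽₄-sound p h f0  = T-∧ˡ (p f0) h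
  all𝔽₄-sound p h f1  = T-∧ˡ (p f1) (T-∧ʳ (p f0) h)
  all𝔽₄-sound p h fω  = T-∧ˡ (p fω) (T-∧ʳ (p f1) (T-∧ʳ (p f0) h))
  all𝔽₄-sound p h fω² = T-∧ʳ (p fω) (T-∧ʳ (p f1) (T-∧ʳ (p f0) h))

  allVec : ∀ n → (Vec 𝔽₄ n → Bool) → Bool
  allVec zero    p = p Vec.[]
  allVec (suc n) p = all𝔽₄ (λ f → allVec n (λ v → p (f Vec.∷ v)))

  allVec-sound : ∀ {n} p → T (allVec n p) → ∀ v → T (p v)
  allVec-sound {zero}  p h Vec.[]       = h
  allVec-sound {suc n} p h (f Vec.∷ v) = allVec-sound (λ v → p (f Vec.∷ v)) (all𝔽₄-sound (λ f → allVec n (λ v → p (f Vec.∷ v))) h f) v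

  anyBool : (Bool → Bool) → Bool
  anyBool p = p false ∨ p true

  anyBool-sound : ∀ p → T (anyBool p) → ∃ λ b → T (p b)
  anyBool-sound p h with T-∨ (p false) h
  ... | inj₁ h₀ = false , h₀
  ... | inj₂ h₁ = true , h₁

  all3 any3 : (Fin 3 → Bool) → Bool
  all3 p = p zero ∧ p (suc zero) ∧ p (suc (suc zero))
  any3 p = p zero ∨ p (suc zero) ∨ p (suc (suc zero))

  all3-sound : ∀ p → T (all3 p) → ∀ a → T (p a)
  all3-sound p h zero             = T-∧ˡ (p zero) h
  all3-sound p h (suc zero)       = T-∧ˡ (p (suc zero)) (T-∧ʳ (p zero) h)
  all3-sound p h (suc (suc zero)) = T-∧ʳ (p (suc zero)) (T-∧ʳ (p zero) h)

  any3-sound : ∀ p → T (any3 p) → ∃ λ a → T (p a)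
  any3-sound p h with T-∨ (p zero) h
  ... | inj₁ h₀ = zero , h₀
  ... | inj₂ h′ with T-∨ (p (suc zero)) h′
  ...   | inj₁ h₁ = suc zero , h₁
  ...   | inj₂ h₂ = suc (suc zero) , h₂

  allSupport anySupport : (Support → Bool) → Bool
  allSupport p = all3 (λ a → all3 (λ b → p (triple a b) ∧ p (quadruple a b)))
               ∧ all3 (λ a → p (quintuple₂ a) ∧ p (quintuple₃ a)) ∧ p septuple
  anySupport p = any3 (λ a → any3 (λ b → p (triple a b) ∨ p (quadruple a b)))
               ∨ any3 (λ a → p (quintuple₂ a) ∨ p (quintuple₃ a)) ∨ p septuple

  allSupport-sound : ∀ p → T (allSupport p) → ∀ S → T (p S)
  allSupport-sound p h = λ where
      (triple a b)    → T-∧ˡ (p (triple a b)) (pairs a b)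
      (quadruple a b) → T-∧ʳ (p (triple a b)) (pairs a b)
      (quintuple₂ a)  → T-∧ˡ (p (quintuple₂ a)) (singles a)
      (quintuple₃ a)  → T-∧ʳ (p (quintuple₂ a)) (singles a)
      septuple        → T-∧ʳ (all3 fives) (T-∧ʳ (all3 λ a → all3 (twos a)) h)
    where
    twos : Fin 3 → Fin 3 → Bool
    twos a b = p (triple a b) ∧ p (quadruple a b)
    fives : Fin 3 → Bool
    fives a = p (quintuple₂ a) ∧ p (quintuple₃ a)
    pairs : ∀ a b → T (twos a b)
    pairs a b = all3-sound (twos a) (all3-sound (λ a → all3 (twos a)) (T-∧ˡ (all3 λ a → all3 (twos a)) h) a) b
    singles : ∀ a → T (fives a)
    singles = all3-sound fives (T-∧ˡ (all3 fives) (T-∧ʳ (all3 λ a → all3 (twos a)) h))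

  anySupport-sound : ∀ p → T (anySupport p) → ∃ λ S → T (p S)
  anySupport-sound p h with T-∨ (any3 λ a → any3 λ b → p (triple a b) ∨ p (quadruple a b)) h
  ... | inj₁ h₁ with any3-sound (λ a → any3 (λ b → p (triple a b) ∨ p (quadruple a b))) h₁
  ...   | a , h₁′ with any3-sound (λ b → p (triple a b) ∨ p (quadruple a b)) h₁′
  ...     | b , h₁″ with T-∨ (p (triple a b)) h₁″
  ...       | inj₁ t = triple a b , t
  ...       | inj₂ q = quadruple a b , q
  anySupport-sound p h | inj₂ h′ with T-∨ (any3 λ a → p (quintuple₂ a) ∨ p (quintuple₃ a)) h′
  ... | inj₂ h₃ = septuple , h₃
  ... | inj₁ h₂ with any3-sound (λ a → p (quintuple₂ a) ∨ p (quintuple₃ a)) h₂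
  ...   | a , h₂′ with T-∨ (p (quintuple₂ a)) h₂′
  ...     | inj₁ q = quintuple₂ a , q
  ...     | inj₂ q = quintuple₃ a , q

  _=ˣ_ : 𝔽₄ˣ → 𝔽₄ˣ → Bool
  one =ˣ one = true
  ω   =ˣ ω   = true
  ω²  =ˣ ω²  = true
  _   =ˣ _   = false

  =ˣ-sound : ∀ {c c′} → T (c =ˣ c′) → c ≡ c′
  =ˣ-sound {one} {one} _ = refl
  =ˣ-sound {ω}   {ω}   _ = refl
  =ˣ-sound {ω²}  {ω²}  _ = refl

  all𝔽₄ˣ : (𝔽₄ˣ → Bool) → Bool
  all𝔽₄ˣ p = p one ∧ p ω ∧ p ω²

  all𝔽₄ˣ-sound : ∀ p → T (all𝔽₄ˣ p) → ∀ c → T (p c)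
  all𝔽₄ˣ-sound p h one = T-∧ˡ (p one) h
  all𝔽₄ˣ-sound p h ω   = T-∧ˡ (p ω) (T-∧ʳ (p one) h)
  all𝔽₄ˣ-sound p h ω²  = T-∧ʳ (p ω) (T-∧ʳ (p one) h)

  private
    orCoincide : (𝔽₄ˣ → 𝔽₄ˣ → 𝔽₄ˣ → Bool) → 𝔽₄ˣ → 𝔽₄ˣ → 𝔽₄ˣ → Bool
    orCoincide p c₁ c₂ c₃ = (c₁ =ˣ c₂) ∨ (c₁ =ˣ c₃) ∨ (c₂ =ˣ c₃) ∨ p c₁ c₂ c₃

  allDistinct : (𝔽₄ˣ → 𝔽₄ˣ → 𝔽₄ˣ → Bool) → Bool
  allDistinct p = all𝔽₄ˣ λ c₁ → all𝔽₄ˣ λ c₂ → all𝔽₄ˣ (orCoincide p c₁ c₂)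

  allDistinct-sound : ∀ p → T (allDistinct p) →
    ∀ {c₁ c₂ c₃} → c₁ ≢ c₂ → c₁ ≢ c₃ → c₂ ≢ c₃ → T (p c₁ c₂ c₃)
  allDistinct-sound p h {c₁} {c₂} {c₃} c₁≢c₂ c₁≢c₃ c₂≢c₃
    with T-∨ (c₁ =ˣ c₂) (all𝔽₄ˣ-sound (orCoincide p c₁ c₂) (all𝔽₄ˣ-sound (λ c₂ → all𝔽₄ˣ (orCoincide p c₁ c₂))
                   (all𝔽₄ˣ-sound (λ c₁ → all𝔽₄ˣ λ c₂ → all𝔽₄ˣ (orCoincide p c₁ c₂)) h c₁) c₂) c₃)
  ... | inj₁ e = ⊥-elim (c₁≢c₂ (=ˣ-sound e))
  ... | inj₂ h₁ with T-∨ (c₁ =ˣ c₃) h₁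
  ...   | inj₁ e = ⊥-elim (c₁≢c₃ (=ˣ-sound e))
  ...   | inj₂ h₂ with T-∨ (c₂ =ˣ c₃) h₂
  ...     | inj₁ e = ⊥-elim (c₂≢c₃ (=ˣ-sound e))
  ...     | inj₂ h₃ = h₃

  ∑F-cong : ∀ {n} {f g : Fin n → 𝔽₄} → (∀ i → f i ≡ g i) → ∑F f ≡ ∑F g
  ∑F-cong {zero}  h = refl
  ∑F-cong {suc n} h = cong₂ _+F_ (h zero) (∑F-cong (λ i → h (suc i)))

  lift-mask : ∀ b f → lift f ⊗ indicator b ≡ lift (mask b f)
  lift-mask true  f = lem (lift f)
    where
    lem : ∀ x → x ⊗ 𝟙 ≡ x
    lem = solve-∀ ℤ[α]-ring
  lift-mask false f = lem (lift f)
    where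
    lem : ∀ x → x ⊗ 𝟘 ≡ 𝟘
    lem = solve-∀ ℤ[α]-ring

  lift-∑-mask : ∀ {n} (g : Fin n → 𝔽₄) (s : Fin n → Bool) →
    sum (λ i → lift (g i) ⊗ indicator (s i)) ≋[ 1 ] lift (∑F (λ i → mask (s i) (g i)))
  lift-∑-mask g s = ≋-trans (≡⇒≋ (sum-cong-≗ (λ i → lift-mask (s i) (g i)))) (lift-∑ (λ i → mask (s i) (g i)))

  module _ (c₁ c₂ c₃ : 𝔽₄ˣ) where

    -- The variables of S that get the value 1 + 2α instead of 1.
    boosted : Support → Bool → Bool → Fin 7 → Bool
    boosted S t₂ t₃ i = i ∈? S ∧ ((i == pivot₂ S ∧ t₂) ∨ (i == pivot₃ S ∧ t₃))

    classSum : Support → ℤ[α]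
    classSum S = sum (λ i → code (classOf c₁ c₂ c₃ i) ⊗ indicator (i ∈? S))

    κ-correct? : Support → Bool
    κ-correct? S = isYes (classSum S ≋[ 2 ]? 𝟚 ⊗ lift (κ c₂ c₃ S))

    annihilates? : Vec 𝔽₄ 7 → Support → Bool
    annihilates? ρ S = isZero (κ c₂ c₃ S +F ∑F (λ i → mask (i ∈? S) (lookup ρ i)))

    boost-annihilates? : Support → 𝔽₄ → Bool → Bool → Bool
    boost-annihilates? S X t₂ t₃ = isZero (X +F ∑F (λ i → mask (boosted S t₂ t₃ i) (fromUnit (classOf c₁ c₂ c₃ i))))

  -- The tables are stated as b ≡ true: checking them by refl is far cheaper than checking T b by tt.
  private
    ≡true⇒T : ∀ {b} → b ≡ true → T b
    ≡true⇒T refl = tt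

    κ-correct-table : allDistinct (λ c₁ c₂ c₃ → allSupport (κ-correct? c₁ c₂ c₃)) ≡ true
    κ-correct-table = refl

    support-exists-table : allDistinct (λ c₁ c₂ c₃ → allVec 7 λ ρ → anySupport (annihilates? c₁ c₂ c₃ ρ)) ≡ true
    support-exists-table = refl

    boost-exists-table : allDistinct (λ c₁ c₂ c₃ → allSupport λ S → all𝔽₄ λ X →
                                        anyBool λ t₂ → anyBool (boost-annihilates? c₁ c₂ c₃ S X t₂)) ≡ true
    boost-exists-table = refl

    pivot₂∈-table : allSupport (λ S → pivot₂ S ∈? S) ≡ true
    pivot₂∈-table = refl

  pivot₂∈ : ∀ S → pivot₂ S ∈? S ≡ true
  pivot₂∈ S = T⇒≡true (allSupport-sound (λ S → pivot₂ S ∈? S) (≡true⇒T pivot₂∈-table) S)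

  module _ {c₁ c₂ c₃ : 𝔽₄ˣ} (c₁≢c₂ : c₁ ≢ c₂) (c₁≢c₃ : c₁ ≢ c₃) (c₂≢c₃ : c₂ ≢ c₃) where
    private
      forDistinct : ∀ p → allDistinct p ≡ true → T (p c₁ c₂ c₃)
      forDistinct p e = allDistinct-sound p (≡true⇒T e) c₁≢c₂ c₁≢c₃ c₂≢c₃

      classOf′ : Fin 7 → 𝔽₄ˣ
      classOf′ = classOf c₁ c₂ c₃

    κ-correct : ∀ S → classSum c₁ c₂ c₃ S ≋[ 2 ] 𝟚 ⊗ lift (κ c₂ c₃ S)
    κ-correct S = toWitness (allSupport-sound (κ-correct? c₁ c₂ c₃) (forDistinct (λ c₁ c₂ c₃ → allSupport (κ-correct? c₁ c₂ c₃)) κ-correct-table) S)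

    private
      support-exists-T : T (allVec 7 λ ρ → anySupport (annihilates? c₁ c₂ c₃ ρ))
      support-exists-T = forDistinct (λ c₁ c₂ c₃ → allVec 7 λ ρ → anySupport (annihilates? c₁ c₂ c₃ ρ)) support-exists-table

      support-exists-v : ∀ v → ∃ λ S → T (annihilates? c₁ c₂ c₃ v S)
      support-exists-v v = anySupport-sound (annihilates? c₁ c₂ c₃ v)
                             (allVec-sound {7} (λ v → anySupport (annihilates? c₁ c₂ c₃ v)) support-exists-T v)

    support-exists : (ρ : Fin 7 → 𝔽₄) → ∃ λ S → κ c₂ c₃ S +F ∑F (λ i → mask (i ∈? S) (ρ i)) ≡ f0
    support-exists ρ = S , trans (cong (κ c₂ c₃ S +F_) (∑F-cong (λ i → cong (mask (i ∈? S)) (sym (lookup∘tabulate ρ i)))))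
                                 (isZero-sound (proj₂ found))
      where
      found = support-exists-v (tabulate ρ)
      S = proj₁ found

    boost-exists : ∀ S X → ∃ λ t₂ → ∃ λ t₃ → X +F ∑F (λ i → mask (boosted c₁ c₂ c₃ S t₂ t₃ i) (fromUnit (classOf′ i))) ≡ f0
    boost-exists S X = t₂ , t₃ , isZero-sound (proj₂ found₃)
      where
      all-boosts : T (allSupport λ S → all𝔽₄ λ X → anyBool λ t₂ → anyBool (boost-annihilates? c₁ c₂ c₃ S X t₂))
      all-boosts = forDistinct (λ c₁ c₂ c₃ → allSupport λ S → all𝔽₄ λ X → anyBool λ t₂ → anyBool (boost-annihilates? c₁ c₂ c₃ S X t₂))
                               boost-exists-table
      found₂ : ∃ λ t₂ → T (anyBool (boost-annihilates? c₁ c₂ c₃ S X t₂))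
      found₂ = anyBool-sound (λ t₂ → anyBool (boost-annihilates? c₁ c₂ c₃ S X t₂))
                 (all𝔽₄-sound (λ X → anyBool λ t₂ → anyBool (boost-annihilates? c₁ c₂ c₃ S X t₂))
                    (allSupport-sound (λ S → all𝔽₄ λ X → anyBool λ t₂ → anyBool (boost-annihilates? c₁ c₂ c₃ S X t₂))
                       all-boosts S) X)
      t₂ = proj₁ found₂
      found₃ = anyBool-sound (boost-annihilates? c₁ c₂ c₃ S X t₂) (proj₂ found₂)
      t₃ = proj₁ found₃

module ModEight where
  open import Data.Nat as ℕ using (ℕ; suc)
  open import Data.Integer as ℤ using (+_)
  open import Data.Product using (_,_; proj₁; proj₂; ∃)
  open import Data.Fin using (Fin)
  open import Data.Bool using (Bool; true; false; _∧_; _∨_)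
  open import Relation.Binary.PropositionalEquality
  open import Tactic.RingSolver using (solve-∀)
  open Arithmetic
  open Congruence
  open Residues
  open FiniteSearch

  data Kind : Set where
    absent plain twisted : Kind

  kind : Bool → Bool → Kind
  kind false _     = absent
  kind true  false = plain
  kind true  true  = twisted

  -- value k is the trial root, weight k its d-th power modulo 8.
  value weight : Kind → ℤ[α]
  value absent  = 𝟘
  value plain   = 𝟙
  value twisted = (+ 1 , + 2)
  weight absent  = 𝟘
  weight plain   = 𝟙
  weight twisted = (+ 5 , + 0)

  weight-kind : ∀ s t → weight (kind s (s ∧ t)) ≡ indicator s ⊕ 𝟚^ 2 ⊗ indicator (s ∧ t)
  weight-kind false _     = refl
  weight-kind true  false = refl
  weight-kind true  true  = refl

  value-unit : ∀ t → value (kind true t) ≋[ 1 ] 𝟙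
  value-unit false = ≋-refl
  value-unit true  = congruent (+ 0 , + 1) refl

  -- (1 + 2α)² ≡ 5 and 5² ≡ 1 (mod 8), and d/2 is odd.
  value^d≋weight : ∀ l k → value k ^ (2 ℕ.* suc (2 ℕ.* l)) ≋[ 3 ] weight k
  value^d≋weight l absent  = ≡⇒≋ (lem (𝟘 ^ (2 ℕ.* l ℕ.+ (suc (2 ℕ.* l) ℕ.+ 0))))
    where
    lem : ∀ x → 𝟘 ⊗ x ≡ 𝟘
    lem = solve-∀ ℤ[α]-ring
  value^d≋weight l plain   = ≡⇒≋ (𝟙^ (2 ℕ.* suc (2 ℕ.* l)))
  value^d≋weight l twisted = begin
    β ^ (2 ℕ.* m)             ≡⟨ ^-*2 β m ⟩
    (β ⊗ β) ^ m               ≈⟨ ^-cong m β² ⟩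
    five ⊗ five ^ (2 ℕ.* l)   ≡⟨ cong (five ⊗_) (^-*2 five l) ⟩
    five ⊗ (five ⊗ five) ^ l  ≈⟨ ⊗-congˡ five (^-cong l five²) ⟩
    five ⊗ 𝟙 ^ l              ≡⟨ cong (five ⊗_) (𝟙^ l) ⟩
    five ⊗ 𝟙                  ≡⟨⟩
    five                      ∎
    where
    open ≋-Reasoning 3
    m = suc (2 ℕ.* l)
    β five : ℤ[α]
    β = value twisted
    five = weight twisted
    β² : β ⊗ β ≋[ 3 ] five
    β² = congruent (+ 0 , + 1) refl
    five² : five ⊗ five ≋[ 3 ] 𝟙
    five² = congruent (+ 3 , + 0) refl

  module _ {c₁ c₂ c₃ : 𝔽₄ˣ} (c₁≢c₂ : c₁ ≢ c₂) (c₁≢c₃ : c₁ ≢ c₃) (c₂≢c₃ : c₂ ≢ c₃) where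
    private
      cl : Fin 7 → 𝔽₄ˣ
      cl = classOf c₁ c₂ c₃

      distrib : ∀ t a b → t ⊗ a ⊕ t ⊗ b ≡ t ⊗ (a ⊕ b)
      distrib = solve-∀ ℤ[α]-ring

    -- abstract: only the statements are needed below, and unfolding the searches is expensive.
    abstract
      support-sum≋𝟘 : (U : Fin 7 → ℤ[α]) → (∀ i → U i ≋[ 1 ] code (cl i)) →
                      ∃ λ S → sum (λ i → U i ⊗ indicator (i ∈? S)) ≋[ 2 ] 𝟘
      support-sum≋𝟘 U U≋class = S , (begin
          sum (λ i → U i ⊗ indicator (s i))               ≡⟨ split ⟩
          classSum c₁ c₂ c₃ S ⊕ 𝟚 ⊗ sum (λ i → r i ⊗ indicator (s i))
                                                          ≈⟨ ⊕-cong (κ-correct c₁≢c₂ c₁≢c₃ c₂≢c₃ S) (𝟚^⊗-cong 1 R≋) ⟩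
          𝟚 ⊗ lift (κ c₂ c₃ S) ⊕ 𝟚 ⊗ lift ΣS             ≡⟨ distrib 𝟚 (lift (κ c₂ c₃ S)) (lift ΣS) ⟩
          𝟚 ⊗ (lift (κ c₂ c₃ S) ⊕ lift ΣS)               ≈⟨ 𝟚^⊗-cong 1 (≋-sym (lift-+ (κ c₂ c₃ S) ΣS)) ⟩
          𝟚 ⊗ lift (κ c₂ c₃ S +F ΣS)                     ≡⟨ cong (λ f → 𝟚 ⊗ lift f) (proj₂ found) ⟩
          𝟘                                               ∎)
        where
        open ≋-Reasoning 2
        r : Fin 7 → ℤ[α]
        r i = quotient (U≋class i)
        ρ : Fin 7 → 𝔽₄
        ρ i = proj₁ (reduce (r i))
        found : ∃ λ S → κ c₂ c₃ S +F ∑F (λ i → mask (i ∈? S) (ρ i)) ≡ f0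
        found = support-exists c₁≢c₂ c₁≢c₃ c₂≢c₃ ρ
        S : Support
        S = proj₁ found
        s : Fin 7 → Bool
        s i = i ∈? S
        ΣS : 𝔽₄
        ΣS = ∑F (λ i → mask (s i) (ρ i))
        R≋ : sum (λ i → r i ⊗ indicator (s i)) ≋[ 1 ] lift ΣS
        R≋ = ≋-trans (sum-cong-≋ (λ i → ⊗-congʳ (indicator (s i)) (proj₂ (reduce (r i))))) (lift-∑-mask ρ s)
        pointwise : ∀ c t r b → (c ⊕ t ⊗ r) ⊗ b ≡ c ⊗ b ⊕ t ⊗ (r ⊗ b)
        pointwise = solve-∀ ℤ[α]-ring
        split : sum (λ i → U i ⊗ indicator (s i)) ≡ classSum c₁ c₂ c₃ S ⊕ 𝟚 ⊗ sum (λ i → r i ⊗ indicator (s i))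
        split = trans (sum-cong-≗ (λ i → trans (cong (_⊗ indicator (s i)) (equality (U≋class i)))
                                              (pointwise (code (cl i)) 𝟚 (r i) (indicator (s i)))))
                (trans (∑-distrib-+ (λ i → code (cl i) ⊗ indicator (s i)) (λ i → 𝟚 ⊗ (r i ⊗ indicator (s i))))
                       (cong (classSum c₁ c₂ c₃ S ⊕_) (sym (*-distribˡ-sum 𝟚 (λ i → r i ⊗ indicator (s i))))))

      boost-sum≋𝟘 : ∀ S X → ∃ λ t₂ → ∃ λ t₃ →
                    X ⊕ sum (λ i → code (cl i) ⊗ indicator (boosted c₁ c₂ c₃ S t₂ t₃ i)) ≋[ 1 ] 𝟘
      boost-sum≋𝟘 S X = t₂ , t₃ , (begin
          X ⊕ sum (λ i → code (cl i) ⊗ indicator (τ i))   ≈⟨ ⊕-cong (proj₂ (reduce X)) Sc≋ ⟩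
          lift fX ⊕ lift ΣT                               ≈⟨ ≋-sym (lift-+ fX ΣT) ⟩
          lift (fX +F ΣT)                                 ≡⟨ cong lift (proj₂ (proj₂ found)) ⟩
          𝟘                                               ∎)
        where
        open ≋-Reasoning 1
        fX : 𝔽₄
        fX = proj₁ (reduce X)
        found : ∃ λ t₂ → ∃ λ t₃ → fX +F ∑F (λ i → mask (boosted c₁ c₂ c₃ S t₂ t₃ i) (fromUnit (cl i))) ≡ f0
        found = boost-exists c₁≢c₂ c₁≢c₃ c₂≢c₃ S fX
        t₂ t₃ : Bool
        t₂ = proj₁ found
        t₃ = proj₁ (proj₂ found)
        τ : Fin 7 → Bool
        τ = boosted c₁ c₂ c₃ S t₂ t₃
        ΣT : 𝔽₄
        ΣT = ∑F (λ i → mask (τ i) (fromUnit (cl i)))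
        Sc≋ : sum (λ i → code (cl i) ⊗ indicator (τ i)) ≋[ 1 ] lift ΣT
        Sc≋ = ≋-trans (≡⇒≋ (sum-cong-≗ (λ i → cong (_⊗ indicator (τ i)) (code≡lift∘fromUnit (cl i)))))
                      (lift-∑-mask (λ i → fromUnit (cl i)) τ)

    module _ (U : Fin 7 → ℤ[α]) (U≋class : ∀ i → U i ≋[ 1 ] code (cl i)) where
      private
        support : ∃ λ S → sum (λ i → U i ⊗ indicator (i ∈? S)) ≋[ 2 ] 𝟘
        support = support-sum≋𝟘 U U≋class
        S : Support
        S = proj₁ support
        s : Fin 7 → Bool
        s i = i ∈? S
        boost : ∃ λ t₂ → ∃ λ t₃ → quotient (proj₂ support) ⊕ sum (λ i → code (cl i) ⊗ indicator (boosted c₁ c₂ c₃ S t₂ t₃ i)) ≋[ 1 ] 𝟘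
        boost = boost-sum≋𝟘 S (quotient (proj₂ support))
        t₂ t₃ : Bool
        t₂ = proj₁ boost
        t₃ = proj₁ (proj₂ boost)
        at-pivot : Fin 7 → Bool
        at-pivot i = (i == pivot₂ S ∧ t₂) ∨ (i == pivot₃ S ∧ t₃)
        τ : Fin 7 → Bool
        τ = boosted c₁ c₂ c₃ S t₂ t₃

      solution : Fin 7 → Kind
      solution i = kind (s i) (τ i)

      pivot : Fin 7
      pivot = pivot₂ S

      value-pivot : value (solution pivot) ≋[ 1 ] 𝟙
      value-pivot = subst (λ b → value (kind b (b ∧ at-pivot pivot)) ≋[ 1 ] 𝟙) (sym (pivot₂∈ S)) (value-unit (at-pivot pivot))

      private
        -- The boosted variables add 4 Σ Uᵢ ≡ 4 Σ cᵢ (mod 8).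
        weighted-sum≋𝟘 : sum (λ i → U i ⊗ weight (solution i)) ≋[ 3 ] 𝟘
        weighted-sum≋𝟘 = begin
          sum (λ i → U i ⊗ weight (solution i))                  ≡⟨ split ⟩
          sum (λ i → U i ⊗ indicator (s i)) ⊕ 𝟚^ 2 ⊗ Sτ          ≡⟨ cong (_⊕ 𝟚^ 2 ⊗ Sτ) (equality (proj₂ support)) ⟩
          (𝟘 ⊕ 𝟚^ 2 ⊗ q) ⊕ 𝟚^ 2 ⊗ Sτ                              ≡⟨ regroup (𝟚^ 2) q Sτ ⟩
          𝟚^ 2 ⊗ (q ⊕ Sτ)                                         ≈⟨ 𝟚^⊗-cong 2 (≋-trans (⊕-cong (≋-refl {x = q}) Sτ≋) (proj₂ (proj₂ boost))) ⟩
          𝟚^ 2 ⊗ 𝟘                                                ≡⟨⟩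
          𝟘                                                       ∎
          where
          open ≋-Reasoning 3
          q : ℤ[α]
          q = quotient (proj₂ support)
          Sτ : ℤ[α]
          Sτ = sum (λ i → U i ⊗ indicator (τ i))
          Sτ≋ : Sτ ≋[ 1 ] sum (λ i → code (cl i) ⊗ indicator (τ i))
          Sτ≋ = sum-cong-≋ (λ i → ⊗-congʳ (indicator (τ i)) (U≋class i))
          pointwise : ∀ f u a b → u ⊗ (a ⊕ f ⊗ b) ≡ u ⊗ a ⊕ f ⊗ (u ⊗ b)
          pointwise = solve-∀ ℤ[α]-ring
          regroup : ∀ f q t → (𝟘 ⊕ f ⊗ q) ⊕ f ⊗ t ≡ f ⊗ (q ⊕ t)
          regroup = solve-∀ ℤ[α]-ring
          split : sum (λ i → U i ⊗ weight (solution i)) ≡ sum (λ i → U i ⊗ indicator (s i)) ⊕ 𝟚^ 2 ⊗ Sτ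
          split = trans (sum-cong-≗ (λ i → trans (cong (U i ⊗_) (weight-kind (s i) (at-pivot i)))
                                                (pointwise (𝟚^ 2) (U i) (indicator (s i)) (indicator (τ i)))))
                  (trans (∑-distrib-+ (λ i → U i ⊗ indicator (s i)) (λ i → 𝟚^ 2 ⊗ (U i ⊗ indicator (τ i))))
                         (cong (sum (λ i → U i ⊗ indicator (s i)) ⊕_) (sym (*-distribˡ-sum (𝟚^ 2) (λ i → U i ⊗ indicator (τ i))))))

      solution-mod8 : ∀ l → sum (λ i → U i ⊗ value (solution i) ^ (2 ℕ.* suc (2 ℕ.* l))) ≋[ 3 ] 𝟘
      solution-mod8 l = ≋-trans (sum-cong-≋ (λ i → ⊗-congˡ (U i) (value^d≋weight l (solution i)))) weighted-sum≋𝟘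

module Hensel where
  open import Data.Nat as ℕ using (ℕ; zero; suc; _≤_; s≤s; z≤n)
  import Data.Nat.Properties as ℕP
  open import Data.Integer as ℤ using (+_)
  import Data.Integer.Properties as ℤP
  open import Data.Product using (Σ; _×_; _,_; proj₁; proj₂)
  open import Data.Bool using (T)
  open import Data.Unit using (tt)
  open import Relation.Binary.PropositionalEquality
  open import Relation.Nullary.Decidable using (isYes; toWitness)
  import Data.Integer.Tactic.RingSolver as ℤ-Solver
  open import Tactic.RingSolver using (solve-∀)
  open Arithmetic
  open Congruence
  open Residues

  fromℕ-odd : ∀ l → fromℕ (suc (2 ℕ.* l)) ≋[ 1 ] 𝟙
  fromℕ-odd l = congruent (fromℕ l) (cong₂ _,_
    (trans (ℤP.pos-+ 1 (2 ℕ.* l)) (trans (cong (λ w → + 1 ℤ.+ w) (ℤP.pos-* 2 l)) (lem₁ (+ l)))) (lem₂ (+ l)))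
    where
    lem₁ : ∀ l → + 1 ℤ.+ + 2 ℤ.* l ≡ + 1 ℤ.+ (+ 2 ℤ.* l ℤ.+ + 0 ℤ.* + 0)
    lem₁ = ℤ-Solver.solve-∀
    lem₂ : ∀ l → + 0 ≡ + 0 ℤ.+ (+ 2 ℤ.* + 0 ℤ.+ + 0 ℤ.* l ℤ.+ + 0 ℤ.* + 0)
    lem₂ = ℤ-Solver.solve-∀

  binomial : ∀ j t z e → (z ⊕ 𝟚^ j ⊗ t) ^ suc e ≋[ j ℕ.+ j ] z ^ suc e ⊕ fromℕ (suc e) ⊗ (𝟚^ j ⊗ t) ⊗ z ^ e
  binomial j t z zero    = ≡⇒≋ (lem z (𝟚^ j ⊗ t))
    where
    lem : ∀ z h → (z ⊕ h) ⊗ 𝟙 ≡ z ⊗ 𝟙 ⊕ 𝟙 ⊗ h ⊗ 𝟙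
    lem = solve-∀ ℤ[α]-ring
  binomial j t z (suc e) = ≋-trans (⊗-congˡ (z ⊕ h) (binomial j t z e)) (congruent _ expand)
    where
    h = 𝟚^ j ⊗ t
    lem : ∀ z w n T t → (z ⊕ T ⊗ t) ⊗ (z ⊗ w ⊕ n ⊗ (T ⊗ t) ⊗ w)
                      ≡ (z ⊗ (z ⊗ w) ⊕ (𝟙 ⊕ n) ⊗ (T ⊗ t) ⊗ (z ⊗ w)) ⊕ (T ⊗ T) ⊗ (t ⊗ t ⊗ n ⊗ w)
    lem = solve-∀ ℤ[α]-ring
    expand : (z ⊕ h) ⊗ (z ^ suc e ⊕ fromℕ (suc e) ⊗ h ⊗ z ^ e)
           ≡ (z ^ suc (suc e) ⊕ fromℕ (suc (suc e)) ⊗ h ⊗ z ^ suc e) ⊕ 𝟚^ (j ℕ.+ j) ⊗ (t ⊗ t ⊗ fromℕ (suc e) ⊗ z ^ e)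
    expand = trans (lem z (z ^ e) (fromℕ (suc e)) (𝟚^ j) t)
                   (cong (λ s → X ⊕ s ⊗ (t ⊗ t ⊗ fromℕ (suc e) ⊗ z ^ e)) (sym (𝟚^-+ j j)))
      where
      X = z ^ suc (suc e) ⊕ fromℕ (suc (suc e)) ⊗ h ⊗ z ^ suc e

  infixl 7 _/F_
  _/F_ : 𝔽₄ → 𝔽₄ˣ → 𝔽₄
  f0  /F _  = f0
  f   /F one = f
  f1  /F ω  = fω²
  fω  /F ω  = f1
  fω² /F ω  = fω
  f1  /F ω² = fω
  fω  /F ω² = fω²
  fω² /F ω² = f1

  -- In characteristic 2, r + (r / c) c = 2 r = 0.
  /F-cancels : ∀ r c → lift r ⊕ lift (r /F c) ⊗ code c ≋[ 1 ] 𝟘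
  /F-cancels r c = toWitness (table r c)
    where
    table : ∀ r c → T (isYes (lift r ⊕ lift (r /F c) ⊗ code c ≋[ 1 ]? 𝟘))
    table f0  one = tt
    table f0  ω   = tt
    table f0  ω²  = tt
    table f1  one = tt
    table f1  ω   = tt
    table f1  ω²  = tt
    table fω  one = tt
    table fω  ω   = tt
    table fω  ω²  = tt
    table fω² one = tt
    table fω² ω   = tt
    table fω² ω²  = tt

  module HenselLift (e m : ℕ) (d≡2m : suc e ≡ 2 ℕ.* m) (m-odd : fromℕ m ≋[ 1 ] 𝟙)
    (A B : ℕ → ℤ[α]) (c : 𝔽₄ˣ)
    (A-coherent : IsCoherent A) (B-coherent : IsCoherent B) (A-class : ∀ n → A (suc n) ≋[ 1 ] code c)
    (y₀ : ℤ[α]) (y₀-odd : y₀ ≋[ 1 ] 𝟙) (y₀-root : A 3 ⊗ y₀ ^ suc e ⊕ B 3 ≋[ 3 ] 𝟘) where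

    private
      d : ℕ
      d = suc e

    g : ℕ → ℤ[α] → ℤ[α]
    g k z = A k ⊗ z ^ d ⊕ B k

    g-coherent : ∀ z → IsCoherent (λ k → g k z)
    g-coherent z k = ⊕-cong (⊗-congʳ (z ^ d) (A-coherent k)) (B-coherent k)

    -- Newton's step: since the derivative d A z^(d-1) has valuation exactly 1, correcting z by
    -- 2^(n+2) t gains one digit of precision.
    abstract
      step : ∀ n z → z ≋[ 1 ] 𝟙 → g (3 ℕ.+ n) z ≋[ 3 ℕ.+ n ] 𝟘 →
             Σ ℤ[α] λ z′ → z′ ≋[ 2 ℕ.+ n ] z × g (4 ℕ.+ n) z′ ≋[ 4 ℕ.+ n ] 𝟘
      step n z z-odd z-root = z ⊕ h , congruent t refl , root′
        where
        k : ℕ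
        k = 3 ℕ.+ n
        A′ B′ r : ℤ[α]
        A′ = A (suc k)
        B′ = B (suc k)
        g≋𝟘 : g (suc k) z ≋[ k ] 𝟘
        g≋𝟘 = ≋-trans (g-coherent z k) z-root
        r = quotient g≋𝟘
        fr : 𝔽₄
        fr = proj₁ (reduce r)
        t h I : ℤ[α]
        t = lift (fr /F c)
        h = 𝟚^ (2 ℕ.+ n) ⊗ t
        I = r ⊕ A′ ⊗ fromℕ m ⊗ t ⊗ z ^ e
        I≋𝟘 : I ≋[ 1 ] 𝟘
        I≋𝟘 = ≋-trans (⊕-cong (proj₂ (reduce r))
                         (⊗-cong (⊗-cong (⊗-cong (A-class k) m-odd) (≋-refl {x = t}))
                                 (≋-trans (^-cong e z-odd) (≡⇒≋ (𝟙^ e)))))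
               (≋-trans (≡⇒≋ (lem (lift fr) (code c) t)) (/F-cancels fr c))
          where
          lem : ∀ R c t → R ⊕ c ⊗ 𝟙 ⊗ t ⊗ 𝟙 ≡ R ⊕ t ⊗ c
          lem = solve-∀ ℤ[α]-ring
        expansion : A′ ⊗ (z ^ d ⊕ fromℕ d ⊗ h ⊗ z ^ e) ⊕ B′ ≡ 𝟚^ k ⊗ I
        expansion = begin
          A′ ⊗ (z ^ d ⊕ fromℕ d ⊗ h ⊗ z ^ e) ⊕ B′
            ≡⟨ lem₁ A′ (z ^ d) B′ (fromℕ d) h (z ^ e) ⟩
          g (suc k) z ⊕ A′ ⊗ (fromℕ d ⊗ h ⊗ z ^ e)
            ≡⟨ cong₂ (λ u w → u ⊕ A′ ⊗ (w ⊗ h ⊗ z ^ e)) (equality g≋𝟘) (trans (cong fromℕ d≡2m) (fromℕ-* 2 m)) ⟩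
          (𝟘 ⊕ 𝟚^ k ⊗ r) ⊕ A′ ⊗ ((𝟚 ⊗ fromℕ m) ⊗ (𝟚^ (2 ℕ.+ n) ⊗ t) ⊗ z ^ e)
            ≡⟨ lem₂ (𝟚^ k) r A′ 𝟚 (fromℕ m) (𝟚^ (2 ℕ.+ n)) t (z ^ e) ⟩
          𝟚^ k ⊗ r ⊕ (𝟚 ⊗ 𝟚^ (2 ℕ.+ n)) ⊗ (A′ ⊗ fromℕ m ⊗ t ⊗ z ^ e)
            ≡⟨ cong (λ s → 𝟚^ k ⊗ r ⊕ s ⊗ (A′ ⊗ fromℕ m ⊗ t ⊗ z ^ e)) (sym (𝟚^-+ 1 (2 ℕ.+ n))) ⟩
          𝟚^ k ⊗ r ⊕ 𝟚^ k ⊗ (A′ ⊗ fromℕ m ⊗ t ⊗ z ^ e)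
            ≡⟨ lem₃ (𝟚^ k) r (A′ ⊗ fromℕ m ⊗ t ⊗ z ^ e) ⟩
          𝟚^ k ⊗ I ∎
          where
          open ≡-Reasoning
          lem₁ : ∀ a z b n h w → a ⊗ (z ⊕ n ⊗ h ⊗ w) ⊕ b ≡ (a ⊗ z ⊕ b) ⊕ a ⊗ (n ⊗ h ⊗ w)
          lem₁ = solve-∀ ℤ[α]-ring
          lem₂ : ∀ K r a two m T t w → (𝟘 ⊕ K ⊗ r) ⊕ a ⊗ ((two ⊗ m) ⊗ (T ⊗ t) ⊗ w) ≡ K ⊗ r ⊕ (two ⊗ T) ⊗ (a ⊗ m ⊗ t ⊗ w)
          lem₂ = solve-∀ ℤ[α]-ring
          lem₃ : ∀ K a b → K ⊗ a ⊕ K ⊗ b ≡ K ⊗ (a ⊕ b)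
          lem₃ = solve-∀ ℤ[α]-ring
        root′ : g (suc k) (z ⊕ h) ≋[ suc k ] 𝟘
        root′ = ≋-trans (⊕-cong (⊗-congˡ A′ (≋-weaken (s≤s (s≤s (ℕP.m≤n+m (2 ℕ.+ n) n))) (binomial (2 ℕ.+ n) t z e)))
                                (≋-refl {x = B′}))
                (≋-trans (≡⇒≋ expansion) (≋-trans (𝟚^⊗-cong k I≋𝟘) (≡⇒≋ (lem (𝟚^ k)))))
          where
          lem : ∀ K → K ⊗ 𝟘 ≡ 𝟘
          lem = solve-∀ ℤ[α]-ring

    approximation : ∀ n → Σ ℤ[α] λ z → z ≋[ 1 ] 𝟙 × g (3 ℕ.+ n) z ≋[ 3 ℕ.+ n ] 𝟘
    approximation zero    = y₀ , y₀-odd , y₀-root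
    approximation (suc n) = proj₁ next , ≋-trans (≋-weaken (s≤s z≤n) (proj₁ (proj₂ next))) z-odd , proj₂ (proj₂ next)
      where
      z = proj₁ (approximation n)
      z-odd = proj₁ (proj₂ (approximation n))
      next = step n z z-odd (proj₂ (proj₂ (approximation n)))

    root : ℕ → ℤ[α]
    root n = proj₁ (approximation n)

    root-odd : ∀ n → root n ≋[ 1 ] 𝟙
    root-odd n = proj₁ (proj₂ (approximation n))

    root-coherent : IsCoherent root
    root-coherent n = ≋-weaken (ℕP.m≤n+m n 2)
      (proj₁ (proj₂ (step n (root n) (root-odd n) (proj₂ (proj₂ (approximation n))))))

    root-solves : ∀ n → A n ⊗ root n ^ d ⊕ B n ≋[ n ] 𝟘
    root-solves n = ≋-trans (≋-sym (IsCoherent-+ (g-coherent (root n)) 3 n))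
                            (≋-weaken (ℕP.m≤n+m n 3) (proj₂ (proj₂ (approximation n))))

module Normalise where
  open import Data.Nat as ℕ using (ℕ; zero; suc; _≤_)
  import Data.Nat.Properties as ℕP
  open import Data.Integer as ℤ using (ℤ; +_; -[1+_])
  import Data.Integer.Properties as ℤP
  import Data.Integer.Divisibility.Signed as Signed
  open import Data.Integer.Divisibility using (_∣_)
  open import Data.Product using (Σ; _,_; proj₁; proj₂)
  open import Data.Fin using (Fin; zero; suc)
  open import Data.Empty using (⊥-elim)
  open import Data.Unit using (tt)
  open import Relation.Binary.PropositionalEquality
  open import Relation.Nullary using (¬_; yes; no)
  open import Relation.Nullary.Decidable using (toWitnessFalse)
  import Data.Integer.Tactic.RingSolver as ℤ-Solver
  open import Tactic.RingSolver using (solve-∀)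
  open Arithmetic
  open Congruence
  open Residues

  Represents : RawK → (ℕ → ℤ[α]) → Set
  Represents r w = ∀ N → num r N ≋[ N ] 𝟚^ (den r) ⊗ w N

  Represents-0K : Represents 0K (λ _ → 𝟘)
  Represents-0K N = ≡⇒≋ (lem (𝟚^ 0))
    where
    lem : ∀ t → 𝟘 ≡ t ⊗ 𝟘
    lem = solve-∀ ℤ[α]-ring

  Represents-+K : ∀ {x y wx wy} → Represents x wx → Represents y wy → Represents (x +K y) (λ N → wx N ⊕ wy N)
  Represents-+K {x} {y} {wx} {wy} hx hy N = begin
    scale2 (den y) (num x) N ⊕ scale2 (den x) (num y) N
      ≡⟨ cong₂ _⊕_ (scale2-at (den y) (num x) N) (scale2-at (den x) (num y) N) ⟩
    𝟚^ (den y) ⊗ num x N ⊕ 𝟚^ (den x) ⊗ num y N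
      ≈⟨ ⊕-cong (⊗-congˡ (𝟚^ (den y)) (hx N)) (⊗-congˡ (𝟚^ (den x)) (hy N)) ⟩
    𝟚^ (den y) ⊗ (𝟚^ (den x) ⊗ wx N) ⊕ 𝟚^ (den x) ⊗ (𝟚^ (den y) ⊗ wy N)
      ≡⟨ lem (𝟚^ (den y)) (𝟚^ (den x)) (wx N) (wy N) ⟩
    (𝟚^ (den x) ⊗ 𝟚^ (den y)) ⊗ (wx N ⊕ wy N)
      ≡⟨ cong (_⊗ (wx N ⊕ wy N)) (sym (𝟚^-+ (den x) (den y))) ⟩
    𝟚^ (den x ℕ.+ den y) ⊗ (wx N ⊕ wy N) ∎
    where
    open ≋-Reasoning N
    lem : ∀ a b u v → a ⊗ (b ⊗ u) ⊕ b ⊗ (a ⊗ v) ≡ (b ⊗ a) ⊗ (u ⊕ v)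
    lem = solve-∀ ℤ[α]-ring

  Represents-sumK : ∀ {s} (g : Fin s → RawK) (w : Fin s → ℕ → ℤ[α]) → (∀ i → Represents (g i) (w i)) →
                    Represents (sumK g) (λ N → sum (λ i → w i N))
  Represents-sumK {zero}  g w h = Represents-0K
  Represents-sumK {suc s} g w h = Represents-+K {g zero} {sumK (λ i → g (suc i))} (h zero) (Represents-sumK (λ i → g (suc i)) (λ i → w (suc i)) (λ i → h (suc i)))

  Represents⇒≈K0 : ∀ {r w} → Represents r w → (∀ N → w N ≋[ N ] 𝟘) → r ≈K 0K
  Represents⇒≈K0 {r} h w≋𝟘 = ≋⇒≈𝒪 λ N → ≋-trans (≡⇒≋ (trans (scale2-at 0 (num r) N) (lem₁ (num r N))))
    (≋-trans (h N) (≋-trans (⊗-congˡ (𝟚^ (den r)) (w≋𝟘 N))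
      (≡⇒≋ (trans (lem₂ (𝟚^ (den r))) (sym (trans (scale2-at (den r) 0𝒪 N) (lem₂ (𝟚^ (den r)))))))))
    where
    lem₁ : ∀ x → 𝟚^ 0 ⊗ x ≡ x
    lem₁ = solve-∀ ℤ[α]-ring
    lem₂ : ∀ t → t ⊗ 𝟘 ≡ 𝟘
    lem₂ = solve-∀ ℤ[α]-ring

  code≉𝟘 : ∀ c → ¬ (code c ≋[ 1 ] 𝟘)
  code≉𝟘 one = toWitnessFalse {a? = code one ≋[ 1 ]? 𝟘} tt
  code≉𝟘 ω   = toWitnessFalse {a? = code ω ≋[ 1 ]? 𝟘} tt
  code≉𝟘 ω²  = toWitnessFalse {a? = code ω² ≋[ 1 ]? 𝟘} tt

  record Normalised (d : ℕ) (a : K) (k : ℤ) (c : 𝔽₄ˣ) : Set where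
    field
      unit            : ℕ → ℤ[α]
      unit-coherent   : IsCoherent unit
      unit-class      : ∀ n → unit (suc n) ≋[ 1 ] code c
      valuation       : ℕ
      num≋            : ∀ N → seq (numK a) N ≋[ N ] 𝟚^ valuation ⊗ unit N
      level-quotient  : ℤ
      valuation-level : + valuation ≡ k ℤ.+ level-quotient ℤ.* + d ℤ.+ + denK a

  module _ (a : K) (u : 𝒪) where
    private
      A U : Raw𝒪
      A = seq (numK a)
      U = seq u
      e : ℕ
      e = denK a
      assoc : ∀ a b x → a ⊗ (b ⊗ x) ≡ (a ⊗ b) ⊗ x
      assoc = solve-∀ ℤ[α]-ring

    num≋-nonnegative : ∀ n → toRaw a ≈K twoPow (+ n) u → ∀ N → A N ≋[ N ] 𝟚^ (e ℕ.+ n) ⊗ U N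
    num≋-nonnegative n a≈ N = ≋-trans (≡⇒≋ (sym (trans (scale2-at 0 A N) (lem (A N)))))
      (≋-trans (≈𝒪⇒≋ {scale2 0 A} {scale2 e (scale2 n U)} a≈ N)
      (≡⇒≋ (trans (scale2-at e (scale2 n U) N) (trans (cong (𝟚^ e ⊗_) (scale2-at n U N))
             (trans (assoc (𝟚^ e) (𝟚^ n) (U N)) (cong (_⊗ U N) (sym (𝟚^-+ e n))))))))
      where
      lem : ∀ x → 𝟚^ 0 ⊗ x ≡ x
      lem = solve-∀ ℤ[α]-ring

    num≋-negative : ∀ n → suc n ≤ e → toRaw a ≈K twoPow -[1+ n ] u → ∀ N → A N ≋[ N ] 𝟚^ (e ℕ.∸ suc n) ⊗ U N
    num≋-negative n n<e a≈ N =
      ≋-trans (≋-sym (IsCoherent-+ (seq-coherent (numK a)) (suc n) N))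
      (≋-trans (𝟚^⊗-cancel (suc n) (subst (λ M → 𝟚^ (suc n) ⊗ A (suc n ℕ.+ N) ≋[ M ] 𝟚^ (suc n) ⊗ (𝟚^ p ⊗ U (suc n ℕ.+ N)))
                                          (ℕP.+-comm (suc n) N) (shifted (suc n ℕ.+ N))))
               (⊗-congˡ (𝟚^ p) (IsCoherent-+ (seq-coherent u) (suc n) N)))
      where
      p = e ℕ.∸ suc n
      shifted : ∀ M → 𝟚^ (suc n) ⊗ A M ≋[ M ] 𝟚^ (suc n) ⊗ (𝟚^ p ⊗ U M)
      shifted M = ≋-trans (≡⇒≋ (sym (scale2-at (suc n) A M)))
        (≋-trans (≈𝒪⇒≋ {scale2 (suc n) A} {scale2 e U} a≈ M)
        (≡⇒≋ (trans (scale2-at e U M) (trans (cong (λ w → 𝟚^ w ⊗ U M) (sym (ℕP.m+[n∸m]≡n n<e)))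
               (trans (cong (_⊗ U M) (𝟚^-+ (suc n) p)) (sym (assoc (𝟚^ (suc n)) (𝟚^ p) (U M))))))))

    -- Otherwise reading a = 2^v u at level den a + 1 would make u divisible by 2.
    exponent-nonnegative : ∀ {c} → HasClass u c → ∀ n → toRaw a ≈K twoPow -[1+ n ] u → suc n ≤ e
    exponent-nonnegative {c} u-class n a≈ with suc n ℕP.≤? e
    ... | yes n<e = n<e
    ... | no n≮e  = ⊥-elim (code≉𝟘 c (≋-trans (≋-sym u-class′) U≋𝟘))
      where
      q = n ℕ.∸ e
      e≤n : e ≤ n
      e≤n = ℕP.≤-pred (ℕP.≰⇒> n≮e)
      n≡ : suc n ≡ e ℕ.+ suc q
      n≡ = trans (cong suc (sym (ℕP.m+[n∸m]≡n e≤n))) (sym (ℕP.+-suc e q))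
      u-class′ : U (suc e) ≋[ 1 ] code c
      u-class′ = ≋-trans (subst (λ j → U j ≋[ 1 ] U 1) (ℕP.+-comm e 1) (IsCoherent-+ (seq-coherent u) e 1))
                         (≡[]⇒≋ (proj₁ u-class) (proj₂ u-class))
      shifted : 𝟚^ e ⊗ (𝟚^ (suc q) ⊗ A (suc e)) ≋[ suc e ] 𝟚^ e ⊗ U (suc e)
      shifted = ≋-trans (≡⇒≋ (trans (trans (assoc (𝟚^ e) (𝟚^ (suc q)) (A (suc e))) (cong (_⊗ A (suc e)) (sym (𝟚^-+ e (suc q)))))
                                    (trans (cong (λ w → 𝟚^ w ⊗ A (suc e)) (sym n≡)) (sym (scale2-at (suc n) A (suc e))))))
                (≋-trans (≈𝒪⇒≋ {scale2 (suc n) A} {scale2 e U} a≈ (suc e)) (≡⇒≋ (scale2-at e U (suc e))))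
      U≋𝟘 : U (suc e) ≋[ 1 ] 𝟘
      U≋𝟘 = ≋-trans (≋-sym (𝟚^⊗-cancel e shifted))
                    (subst (λ w → w ⊗ A (suc e) ≋[ 1 ] 𝟘) (sym (𝟚^-+ 1 q))
                       (subst (λ w → w ≋[ 1 ] 𝟘) (assoc 𝟚 (𝟚^ q) (A (suc e))) (𝟚^⊗≋𝟘 (𝟚^ q ⊗ A (suc e)))))

  private
    level : ∀ {d k} v e → (+ d) ∣ (v ℤ.- k) → ∀ h → + h ≡ v ℤ.+ + e → Σ ℤ λ z → + h ≡ k ℤ.+ z ℤ.* + d ℤ.+ + e
    level {d} {k} v e d∣v-k h eq with Signed.∣ᵤ⇒∣ {+ d} {v ℤ.- k} d∣v-k
    ... | Signed.divides z v-k≡ = z , trans eq (cong (λ w → w ℤ.+ + e) (trans (lem v k) (cong (λ w → k ℤ.+ w) v-k≡)))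
      where
      lem : ∀ v k → v ≡ k ℤ.+ (v ℤ.- k)
      lem = ℤ-Solver.solve-∀

    from-unit : ∀ {d a k c} (u : 𝒪) → HasClass u c → ∀ h → (∀ N → seq (numK a) N ≋[ N ] 𝟚^ h ⊗ seq u N) →
                (Σ ℤ λ z → + h ≡ k ℤ.+ z ℤ.* + d ℤ.+ + denK a) → Normalised d a k c
    from-unit u u-class h num≋ (z , eq) = record
      { unit = seq u ; unit-coherent = seq-coherent u
      ; unit-class = λ n → ≋-trans (subst (λ j → seq u j ≋[ 1 ] seq u 1) (ℕP.+-comm n 1) (IsCoherent-+ (seq-coherent u) n 1))
                                   (≡[]⇒≋ (proj₁ u-class) (proj₂ u-class))
      ; valuation = h ; num≋ = num≋ ; level-quotient = z ; valuation-level = eq }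

  normalise : ∀ {d a k c} → LevelClass d a k c → Normalised d a k c
  normalise {d} {a} {k} {c} (+ n , u , a≈ , u-class , d∣v-k) =
    from-unit u u-class (e ℕ.+ n) (num≋-nonnegative a u n a≈)
      (level {d} {k} (+ n) e d∣v-k (e ℕ.+ n) (trans (cong +_ (ℕP.+-comm e n)) (ℤP.pos-+ n e)))
    where
    e = denK a
  normalise {d} {a} {k} {c} (-[1+ n ] , u , a≈ , u-class , d∣v-k) =
    from-unit u u-class p (num≋-negative a u n n<e a≈)
      (level {d} {k} -[1+ n ] e d∣v-k p (subst (λ w → + p ≡ -[1+ n ] ℤ.+ + w) (ℕP.m+[n∸m]≡n n<e) (lem n p)))
    where
    e = denK a
    n<e = exponent-nonnegative a u {c} u-class n a≈
    p = e ℕ.∸ suc n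
    lem : ∀ n p → + p ≡ -[1+ n ] ℤ.+ + (suc n ℕ.+ p)
    lem n p = trans (lem′ (+ suc n) (+ p)) (cong (λ w → -[1+ n ] ℤ.+ w) (sym (ℤP.pos-+ (suc n) p)))
      where
      lem′ : ∀ a b → b ≡ ℤ.- a ℤ.+ (a ℤ.+ b)
      lem′ = ℤ-Solver.solve-∀

  -- Shifting the exponents of 2 by multiples of d = suc d′: with x = 2^raise / 2^lower, every variable of
  -- level k acquires the common valuation offset = k + d |k| ≥ 0.
  offset : ℕ → ℤ → ℕ
  offset d′ (+ n)    = n ℕ.+ suc d′ ℕ.* n
  offset d′ -[1+ n ] = d′ ℕ.* suc n

  raise lower : ℤ → ℤ → ℕ
  raise k (+ n)    = ℤ.∣ k ∣
  raise k -[1+ n ] = ℤ.∣ k ∣ ℕ.+ suc n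
  lower k (+ n)    = n
  lower k -[1+ n ] = 0

  private
    offset-≡ : ∀ d′ k → + offset d′ k ≡ k ℤ.+ + suc d′ ℤ.* + ℤ.∣ k ∣
    offset-≡ d′ (+ n)    = trans (ℤP.pos-+ n (suc d′ ℕ.* n)) (cong (λ w → + n ℤ.+ w) (ℤP.pos-* (suc d′) n))
    offset-≡ d′ -[1+ n ] = trans (ℤP.pos-* d′ (suc n))
                          (trans (lem (+ d′) (+ suc n)) (cong (λ w → -[1+ n ] ℤ.+ w ℤ.* + suc n) (sym (ℤP.pos-+ 1 d′))))
      where
      lem : ∀ d m → d ℤ.* m ≡ ℤ.- m ℤ.+ (+ 1 ℤ.+ d) ℤ.* m
      lem = ℤ-Solver.solve-∀

    raise-lower : ∀ k z → z ℤ.+ + raise k z ≡ + lower k z ℤ.+ + ℤ.∣ k ∣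
    raise-lower k (+ n)    = refl
    raise-lower k -[1+ n ] = trans (cong (λ w → -[1+ n ] ℤ.+ w) (ℤP.pos-+ ℤ.∣ k ∣ (suc n))) (lem (+ ℤ.∣ k ∣) (+ suc n))
      where
      lem : ∀ a m → ℤ.- m ℤ.+ (a ℤ.+ m) ≡ + 0 ℤ.+ a
      lem = ℤ-Solver.solve-∀

  common-valuation : ∀ d′ k z h e → + h ≡ k ℤ.+ z ℤ.* + suc d′ ℤ.+ + e →
    h ℕ.+ suc d′ ℕ.* raise k z ≡ e ℕ.+ suc d′ ℕ.* lower k z ℕ.+ offset d′ k
  common-valuation d′ k z h e eq = ℤP.+-injective (begin
    + (h ℕ.+ D ℕ.* α)                            ≡⟨ ℕ-to-ℤ h α ⟩
    + h ℤ.+ + D ℤ.* + α                           ≡⟨ cong (λ w → w ℤ.+ + D ℤ.* + α) eq ⟩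
    k ℤ.+ z ℤ.* + D ℤ.+ + e ℤ.+ + D ℤ.* + α       ≡⟨ lem₁ k z (+ D) (+ e) (+ α) ⟩
    k ℤ.+ + e ℤ.+ + D ℤ.* (z ℤ.+ + α)             ≡⟨ cong (λ w → k ℤ.+ + e ℤ.+ + D ℤ.* w) (raise-lower k z) ⟩
    k ℤ.+ + e ℤ.+ + D ℤ.* (+ β ℤ.+ + ℤ.∣ k ∣)     ≡⟨ lem₂ k (+ D) (+ e) (+ β) (+ ℤ.∣ k ∣) ⟩
    + e ℤ.+ + D ℤ.* + β ℤ.+ (k ℤ.+ + D ℤ.* + ℤ.∣ k ∣) ≡⟨ cong (λ w → + e ℤ.+ + D ℤ.* + β ℤ.+ w) (sym (offset-≡ d′ k)) ⟩
    + e ℤ.+ + D ℤ.* + β ℤ.+ + offset d′ k         ≡⟨ cong (λ w → w ℤ.+ + offset d′ k) (sym (ℕ-to-ℤ e β)) ⟩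
    + (e ℕ.+ D ℕ.* β) ℤ.+ + offset d′ k           ≡⟨ sym (ℤP.pos-+ (e ℕ.+ D ℕ.* β) (offset d′ k)) ⟩
    + (e ℕ.+ D ℕ.* β ℕ.+ offset d′ k)             ∎)
    where
    open ≡-Reasoning
    D α β : ℕ
    D = suc d′
    α = raise k z
    β = lower k z
    ℕ-to-ℤ : ∀ a b → + (a ℕ.+ D ℕ.* b) ≡ + a ℤ.+ + D ℤ.* + b
    ℕ-to-ℤ a b = trans (ℤP.pos-+ a (D ℕ.* b)) (cong (λ w → + a ℤ.+ w) (ℤP.pos-* D b))
    lem₁ : ∀ k z D e a → k ℤ.+ z ℤ.* D ℤ.+ e ℤ.+ D ℤ.* a ≡ k ℤ.+ e ℤ.+ D ℤ.* (z ℤ.+ a)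
    lem₁ = ℤ-Solver.solve-∀
    lem₂ : ∀ k D e b m → k ℤ.+ e ℤ.+ D ℤ.* (b ℤ.+ m) ≡ e ℤ.+ D ℤ.* b ℤ.+ (k ℤ.+ D ℤ.* m)
    lem₂ = ℤ-Solver.solve-∀

module Reindex where
  open import Data.Nat using (zero; suc)
  open import Data.Fin using (Fin; zero; suc)
  open import Data.Fin.Properties using (_≟_; any?)
  open import Data.Bool using (true; false; if_then_else_)
  open import Data.Product using (∃; _,_)
  open import Data.Empty using (⊥-elim)
  open import Function.Definitions using (Injective)
  open import Relation.Binary.PropositionalEquality
  open import Relation.Nullary using (Dec; yes; no; does)
  open import Relation.Nullary.Decidable using (dec-true; dec-false)
  open import Tactic.RingSolver using (solve-∀)
  open Arithmetic
  open Residues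

  δ : ∀ {n} → Fin n → Fin n → ℤ[α]
  δ a b = if does (a ≟ b) then 𝟙 else 𝟘

  private
    𝟙⊗ : ∀ x → 𝟙 ⊗ x ≡ x
    𝟙⊗ = solve-∀ ℤ[α]-ring
    𝟘⊗ : ∀ x → 𝟘 ⊗ x ≡ 𝟘
    𝟘⊗ = solve-∀ ℤ[α]-ring
    ⊕𝟘 : ∀ x → x ⊕ 𝟘 ≡ x
    ⊕𝟘 = solve-∀ ℤ[α]-ring

  sum-𝟘 : ∀ {n} {f : Fin n → ℤ[α]} → (∀ i → f i ≡ 𝟘) → sum f ≡ 𝟘
  sum-𝟘 {n} h = trans (sum-cong-≗ h) (sum-replicate-zero n)

  sum-δ : ∀ {n} a (f : Fin n → ℤ[α]) → sum (λ b → δ a b ⊗ f b) ≡ f a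
  sum-δ zero    f = trans (cong₂ _⊕_ (𝟙⊗ (f zero)) (sum-𝟘 (λ b → 𝟘⊗ (f (suc b))))) (⊕𝟘 (f zero))
  sum-δ (suc a) f = trans (cong (_⊕ sum (λ b → δ a b ⊗ f (suc b))) (𝟘⊗ (f zero))) (trans (cong (𝟘 ⊕_) (sum-δ a (λ b → f (suc b)))) (𝟘⊕ (f (suc a))))
    where
    𝟘⊕ : ∀ x → 𝟘 ⊕ x ≡ x
    𝟘⊕ = solve-∀ ℤ[α]-ring

  module _ {m n} (idx : Fin m → Fin n) (idx-injective : Injective _≡_ _≡_ idx) where

    pick : ∀ {A : Set} {i} → A → (Fin m → A) → Dec (∃ λ j → idx j ≡ i) → A
    pick a₀ f (yes (j , _)) = f j
    pick a₀ f (no _)        = a₀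

    extend : ∀ {A : Set} → A → (Fin m → A) → Fin n → A
    extend a₀ f i = pick a₀ f (any? (λ j → idx j ≟ i))

    pick-image : ∀ {A : Set} (a₀ : A) f j (p : Dec (∃ λ j′ → idx j′ ≡ idx j)) → pick a₀ f p ≡ f j
    pick-image a₀ f j (yes (j′ , e)) = cong f (idx-injective e)
    pick-image a₀ f j (no ¬p)        = ⊥-elim (¬p (j , refl))

    extend-image : ∀ {A : Set} (a₀ : A) f j → extend a₀ f (idx j) ≡ f j
    extend-image a₀ f j = pick-image a₀ f j (any? (λ j′ → idx j′ ≟ idx j))

    private
      δ-idx : ∀ j₀ j → δ (idx j) (idx j₀) ≡ δ j₀ j
      δ-idx j₀ j with j₀ ≟ j
      ... | yes refl = cong (λ b → if b then 𝟙 else 𝟘) (dec-true (idx j ≟ idx j) refl)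
      ... | no j₀≢j  = cong (λ b → if b then 𝟙 else 𝟘) (dec-false (idx j ≟ idx j₀) (λ e → j₀≢j (sym (idx-injective e))))

      pick-as-sum : ∀ (W : Fin m → ℤ[α]) i (p : Dec (∃ λ j → idx j ≡ i)) → pick 𝟘 W p ≡ sum (λ j → δ (idx j) i ⊗ W j)
      pick-as-sum W .(idx j₀) (yes (j₀ , refl)) = sym (trans (sum-cong-≗ (λ j → cong (_⊗ W j) (δ-idx j₀ j))) (sum-δ j₀ W))
      pick-as-sum W i (no ¬p) = sym (sum-𝟘 (λ j → trans (cong (λ b → (if b then 𝟙 else 𝟘) ⊗ W j) (dec-false (idx j ≟ i) (λ e → ¬p (j , e))))
                                                        (𝟘⊗ (W j))))

    sum-extend : ∀ (W : Fin m → ℤ[α]) → sum (extend 𝟘 W) ≡ sum W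
    sum-extend W = begin
      sum (extend 𝟘 W)                              ≡⟨ sum-cong-≗ (λ i → pick-as-sum W i (any? (λ j → idx j ≟ i))) ⟩
      sum (λ i → sum (λ j → δ (idx j) i ⊗ W j))     ≡⟨ ∑-comm (λ i j → δ (idx j) i ⊗ W j) ⟩
      sum (λ j → sum (λ i → δ (idx j) i ⊗ W j))     ≡⟨ sum-cong-≗ (λ j → sum-δ (idx j) (λ _ → W j)) ⟩
      sum W                                         ∎
      where open ≡-Reasoning

module NontrivialZero where
  open import Data.Nat as ℕ using (ℕ; zero; suc)
  open import Data.Integer as ℤ using (ℤ; +_)
  open import Data.Fin using (Fin; zero; suc; punchIn)
  open import Data.Fin.Properties using (_≟_; punchInᵢ≢i)
  open import Data.Bool using (true; false; if_then_else_)
  open import Data.Product using (Σ; ∃; _×_; _,_)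
  open import Data.Vec.Functional using (removeAt)
  open import Function.Definitions using (Injective)
  open import Relation.Binary.PropositionalEquality
  open import Relation.Nullary using (¬_; does)
  open import Relation.Nullary.Decidable using (dec-true; dec-false)
  open import Tactic.RingSolver using (solve-∀)
  open Arithmetic
  open Congruence
  open Residues
  open FiniteSearch using (classOf)
  open ModEight
  open Hensel
  open Normalise
  open Reindex

  if-≋ : ∀ b {n x x′ y} → x ≋[ n ] x′ → (if b then x else y) ≋[ n ] (if b then x′ else y)
  if-≋ true  h = h
  if-≋ false h = ≋-refl

  0K′ : K
  0K′ = mkK (mk𝒪 0𝒪 (IsCoherent⇒Coherent {0𝒪} (λ n → ≋-refl))) 0

  module Zero (l s : ℕ) (a : Fin s → K) (k : ℤ) {c₁ c₂ c₃ : 𝔽₄ˣ}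
    (c₁≢c₂ : c₁ ≢ c₂) (c₁≢c₃ : c₁ ≢ c₃) (c₂≢c₃ : c₂ ≢ c₃)
    (idx : Fin 7 → Fin s) (idx-injective : Injective _≡_ _≡_ idx)
    (level-class : ∀ j → LevelClass (2 ℕ.* suc (2 ℕ.* l)) (a (idx j)) k (classOf c₁ c₂ c₃ j)) where

    -- d = 2m = e + 1 with m = 2l + 1.
    m e d : ℕ
    m = suc (2 ℕ.* l)
    e = 2 ℕ.* l ℕ.+ (m ℕ.+ 0)
    d = 2 ℕ.* m

    open Normalised

    nf : ∀ j → Normalised d (a (idx j)) k (classOf c₁ c₂ c₃ j)
    nf j = normalise (level-class j)

    U : Fin 7 → ℕ → ℤ[α]
    U j = unit (nf j)

    U₃ : Fin 7 → ℤ[α]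
    U₃ j = U j 3

    U₃-class : ∀ j → U₃ j ≋[ 1 ] code (classOf c₁ c₂ c₃ j)
    U₃-class j = unit-class (nf j) 2

    p : Fin 7
    p = pivot c₁≢c₂ c₁≢c₃ c₂≢c₃ U₃ U₃-class

    y₀ : Fin 7 → ℤ[α]
    y₀ j = value (solution c₁≢c₂ c₁≢c₃ c₂≢c₃ U₃ U₃-class j)

    others : ℕ → ℤ[α]
    others n = sum (removeAt (λ j → U j n ⊗ y₀ j ^ d) p)

    others-coherent : IsCoherent others
    others-coherent n = sum-cong-≋ (λ i → ⊗-congʳ (y₀ (punchIn p i) ^ d) (unit-coherent (nf (punchIn p i)) n))

    y₀-root : U p 3 ⊗ y₀ p ^ d ⊕ others 3 ≋[ 3 ] 𝟘
    y₀-root = ≋-trans (≡⇒≋ (sym (sum-remove {i = p} (λ j → U j 3 ⊗ y₀ j ^ d))))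
                      (solution-mod8 c₁≢c₂ c₁≢c₃ c₂≢c₃ U₃ U₃-class l)

    open HenselLift e m refl (fromℕ-odd l) (U p) others (classOf c₁ c₂ c₃ p)
                    (unit-coherent (nf p)) others-coherent (unit-class (nf p))
                    (y₀ p) (value-pivot c₁≢c₂ c₁≢c₃ c₂≢c₃ U₃ U₃-class) y₀-root

    Y : ℕ → Fin 7 → ℤ[α]
    Y n j = if does (j ≟ p) then root n else y₀ j

    Y-pivot : ∀ n → Y n p ≡ root n
    Y-pivot n = cong (λ b → if b then root n else y₀ p) (dec-true (p ≟ p) refl)

    Y-other : ∀ n j → j ≢ p → Y n j ≡ y₀ j
    Y-other n j j≢p = cong (λ b → if b then root n else y₀ j) (dec-false (j ≟ p) j≢p)

    Y-root : ∀ n → sum (λ j → U j n ⊗ Y n j ^ d) ≋[ n ] 𝟘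
    Y-root n = ≋-trans (≡⇒≋ (trans (sum-remove {i = p} (λ j → U j n ⊗ Y n j ^ d)) (cong₂ _⊕_ at-pivot off-pivot)))
                       (root-solves n)
      where
      at-pivot : U p n ⊗ Y n p ^ d ≡ U p n ⊗ root n ^ d
      at-pivot = cong (λ y → U p n ⊗ y ^ d) (Y-pivot n)
      off-pivot : sum (removeAt (λ j → U j n ⊗ Y n j ^ d) p) ≡ others n
      off-pivot = sum-cong-≗ (λ i → cong (λ y → U (punchIn p i) n ⊗ y ^ d) (Y-other n (punchIn p i) (punchInᵢ≢i p i)))

    raiseⱼ lowerⱼ : Fin 7 → ℕ
    raiseⱼ j = raise k (level-quotient (nf j))
    lowerⱼ j = lower k (level-quotient (nf j))

    X : Fin 7 → ℕ → ℤ[α]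
    X j n = 𝟚^ (raiseⱼ j) ⊗ Y n j

    xⱼ : Fin 7 → K
    xⱼ j = mkK (mk𝒪 (X j) (IsCoherent⇒Coherent {X j} (λ n → ⊗-congˡ (𝟚^ (raiseⱼ j)) (if-≋ (does (j ≟ p)) (root-coherent n)))))
               (lowerⱼ j)

    W : Fin 7 → ℕ → ℤ[α]
    W j n = 𝟚^ (offset e k) ⊗ (U j n ⊗ Y n j ^ d)

    -- All seven terms have the common valuation offset e k.
    term : ∀ j → Represents (toRaw (a (idx j)) *K (toRaw (xⱼ j) ^K d)) (W j)
    term j n = begin
      seq (numK (a (idx j))) n ⊗ (X j ^𝒪 d) n              ≡⟨ cong (seq (numK (a (idx j))) n ⊗_) (^𝒪-at (X j) d n) ⟩
      seq (numK (a (idx j))) n ⊗ X j n ^ d                 ≈⟨ ⊗-congʳ (X j n ^ d) (num≋ (nf j) n) ⟩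
      (𝟚^ h ⊗ U j n) ⊗ (𝟚^ α ⊗ Y n j) ^ d                  ≡⟨ cong ((𝟚^ h ⊗ U j n) ⊗_) (trans (^-distrib-⊗ (𝟚^ α) (Y n j) d) (cong (_⊗ Y n j ^ d) (𝟚^-^ α d))) ⟩
      (𝟚^ h ⊗ U j n) ⊗ (𝟚^ (d ℕ.* α) ⊗ Y n j ^ d)          ≡⟨ lem₁ (𝟚^ h) (U j n) (𝟚^ (d ℕ.* α)) (Y n j ^ d) ⟩
      (𝟚^ h ⊗ 𝟚^ (d ℕ.* α)) ⊗ (U j n ⊗ Y n j ^ d)          ≡⟨ cong (_⊗ (U j n ⊗ Y n j ^ d)) (sym (𝟚^-+ h (d ℕ.* α))) ⟩
      𝟚^ (h ℕ.+ d ℕ.* α) ⊗ (U j n ⊗ Y n j ^ d)              ≡⟨ cong (λ t → 𝟚^ t ⊗ (U j n ⊗ Y n j ^ d)) valuations ⟩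
      𝟚^ (δ₀ ℕ.+ offset e k) ⊗ (U j n ⊗ Y n j ^ d)          ≡⟨ cong (_⊗ (U j n ⊗ Y n j ^ d)) (𝟚^-+ δ₀ (offset e k)) ⟩
      (𝟚^ δ₀ ⊗ 𝟚^ (offset e k)) ⊗ (U j n ⊗ Y n j ^ d)       ≡⟨ lem₂ (𝟚^ δ₀) (𝟚^ (offset e k)) (U j n ⊗ Y n j ^ d) ⟩
      𝟚^ δ₀ ⊗ W j n                                         ∎
      where
      open ≋-Reasoning n
      h α δ₀ : ℕ
      h = valuation (nf j)
      α = raiseⱼ j
      δ₀ = denK (a (idx j)) ℕ.+ d ℕ.* lowerⱼ j
      valuations : h ℕ.+ d ℕ.* α ≡ δ₀ ℕ.+ offset e k
      valuations = common-valuation e k (level-quotient (nf j)) h (denK (a (idx j))) (valuation-level (nf j))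
      lem₁ : ∀ a b c y → (a ⊗ b) ⊗ (c ⊗ y) ≡ (a ⊗ c) ⊗ (b ⊗ y)
      lem₁ = solve-∀ ℤ[α]-ring
      lem₂ : ∀ a b x → (a ⊗ b) ⊗ x ≡ a ⊗ (b ⊗ x)
      lem₂ = solve-∀ ℤ[α]-ring

    term-0 : ∀ i → Represents (toRaw (a i) *K (toRaw 0K′ ^K d)) (λ _ → 𝟘)
    term-0 i n = ≡⇒≋ (trans (cong (seq (numK (a i)) n ⊗_) (^𝒪-at 0𝒪 d n))
                     (trans (lem₁ (seq (numK (a i)) n) (𝟘 ^ e)) (sym (lem₂ (𝟚^ (denK (a i) ℕ.+ d ℕ.* 0))))))
      where
      lem₁ : ∀ x y → x ⊗ (𝟘 ⊗ y) ≡ 𝟘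
      lem₁ = solve-∀ ℤ[α]-ring
      lem₂ : ∀ t → t ⊗ 𝟘 ≡ 𝟘
      lem₂ = solve-∀ ℤ[α]-ring

    x : Fin s → K
    x = extend idx idx-injective 0K′ xⱼ

    w : Fin s → ℕ → ℤ[α]
    w i n = extend idx idx-injective 𝟘 (λ j → W j n) i

    term-x : ∀ i → Represents (toRaw (a i) *K (toRaw (x i) ^K d)) (w i)
    term-x i = picked (Data.Fin.Properties.any? (λ j → idx j ≟ i))
      where
      picked : ∀ q → Represents (toRaw (a i) *K (toRaw (pick idx idx-injective 0K′ xⱼ q) ^K d))
                                (λ n → pick idx idx-injective 𝟘 (λ j → W j n) q)
      picked (Relation.Nullary.yes (j , refl)) = term j
      picked (Relation.Nullary.no _)           = term-0 i

    sum-w≋𝟘 : ∀ n → sum (λ i → w i n) ≋[ n ] 𝟘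
    sum-w≋𝟘 n = begin
      sum (λ i → w i n)                                      ≡⟨ sum-extend idx idx-injective (λ j → W j n) ⟩
      sum (λ j → W j n)                                      ≡⟨ sym (*-distribˡ-sum (𝟚^ (offset e k)) (λ j → U j n ⊗ Y n j ^ d)) ⟩
      𝟚^ (offset e k) ⊗ sum (λ j → U j n ⊗ Y n j ^ d)        ≈⟨ ⊗-congˡ (𝟚^ (offset e k)) (Y-root n) ⟩
      𝟚^ (offset e k) ⊗ 𝟘                                    ≡⟨ lem (𝟚^ (offset e k)) ⟩
      𝟘                                                      ∎
      where
      open ≋-Reasoning n
      lem : ∀ t → t ⊗ 𝟘 ≡ 𝟘
      lem = solve-∀ ℤ[α]-ring

    form≈0 : evalForm d a x ≈K 0K
    form≈0 = Represents⇒≈K0 {evalForm d a x} {λ n → sum (λ i → w i n)} (Represents-sumK (λ i → toRaw (a i) *K (toRaw (x i) ^K d)) w term-x) sum-w≋𝟘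

    xⱼ-nontrivial : ¬ (toRaw (xⱼ p) ≈K 0K)
    xⱼ-nontrivial x≈0 = code≉𝟘 one (≋-trans (≋-sym (root-odd (suc α))) (𝟚^⊗-cancel α (≋-trans at-level (≡⇒≋ (sym (lem (𝟚^ α)))))))
      where
      α : ℕ
      α = raiseⱼ p
      lem : ∀ t → t ⊗ 𝟘 ≡ 𝟘
      lem = solve-∀ ℤ[α]-ring
      lem₀ : ∀ y → 𝟚^ 0 ⊗ y ≡ y
      lem₀ = solve-∀ ℤ[α]-ring
      at-level : 𝟚^ α ⊗ root (suc α) ≋[ suc α ] 𝟘
      at-level = ≋-trans (≡⇒≋ (sym (trans (scale2-at 0 (X p) (suc α)) (trans (lem₀ (X p (suc α))) (cong (𝟚^ α ⊗_) (Y-pivot (suc α)))))))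
                 (≋-trans (≈𝒪⇒≋ {scale2 0 (X p)} {scale2 (lowerⱼ p) 0𝒪} x≈0 (suc α))
                          (≡⇒≋ (trans (scale2-at (lowerⱼ p) 0𝒪 (suc α)) (lem (𝟚^ (lowerⱼ p))))))

    x-nontrivial : ¬ (toRaw (x (idx p)) ≈K 0K)
    x-nontrivial = subst (λ y → ¬ (toRaw y ≈K 0K)) (sym (extend-image idx idx-injective 0K′ xⱼ p)) xⱼ-nontrivial

    nontrivial-zero : Σ (Fin s → K) λ x → (∃ λ i → ¬ (toRaw (x i) ≈K 0K)) × (evalForm d a x ≈K 0K)
    nontrivial-zero = x , (idx p , x-nontrivial) , form≈0

open FiniteSearch using (classOf)
open NontrivialZero

odd⇒suc-double : ∀ m → m % 2 ≡ 1 → Σ ℕ λ l → m ≡ 1 + 2 * l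
odd⇒suc-double m m%2≡1 = m / 2 , trans (m≡m%n+[m/n]*n m 2) (trans (cong (_+ m / 2 * 2) m%2≡1) (cong (1 +_) (*-comm (m / 2) 2)))

lemma12 : (m : ℕ) → 3 ≤ m → m % 2 ≡ 1 →
  (s : ℕ) (a : Fin s → K) →
  (k : ℤ) (c₁ c₂ c₃ : 𝔽₄ˣ) → c₁ ≢ c₂ → c₁ ≢ c₃ → c₂ ≢ c₃ →
  (idx : Fin 7 → Fin s) → Injective _≡_ _≡_ idx →
  LevelClass (2 * m) (a (idx zero)) k c₁ →
  LevelClass (2 * m) (a (idx (suc zero))) k c₂ →
  LevelClass (2 * m) (a (idx (suc (suc zero)))) k c₂ →
  LevelClass (2 * m) (a (idx (suc (suc (suc zero))))) k c₂ →
  LevelClass (2 * m) (a (idx (suc (suc (suc (suc zero)))))) k c₃ →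
  LevelClass (2 * m) (a (idx (suc (suc (suc (suc (suc zero))))))) k c₃ →
  LevelClass (2 * m) (a (idx (suc (suc (suc (suc (suc (suc zero)))))))) k c₃ →
  Σ (Fin s → K) λ x →
    (∃ λ i → ¬ (toRaw (x i) ≈K 0K)) × (evalForm (2 * m) a x ≈K 0K)
lemma12 m _ m-odd s a k c₁ c₂ c₃ c₁≢c₂ c₁≢c₃ c₂≢c₃ idx idx-injective L₀ L₁ L₂ L₃ L₄ L₅ L₆
  with odd⇒suc-double m m-odd
... | l , refl = Zero.nontrivial-zero l s a k c₁≢c₂ c₁≢c₃ c₂≢c₃ idx idx-injective level-class
  where
  level-class : ∀ j → LevelClass (2 * m) (a (idx j)) k (classOf c₁ c₂ c₃ j)
  level-class zero                                   = L₀
  level-class (suc zero)                             = L₁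
  level-class (suc (suc zero))                       = L₂
  level-class (suc (suc (suc zero)))                 = L₃
  level-class (suc (suc (suc (suc zero))))           = L₄
  level-class (suc (suc (suc (suc (suc zero)))))     = L₅
  level-class (suc (suc (suc (suc (suc (suc zero)))))) = L₆
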